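{- Let $M$ be a $\lambda$-term. The following statements are equivalent: (i) there exists $a\in T_r(M)$ such that $NF(a)$ is a positive rigid term; (ii) there exist $a\in T_r(M)$ and $m\in\mathbb N$ such that $L_r^m(a)$ is a positive rigid term in $\to_r$-normal form; (iii) there exists $m\in\mathbb N$ such that $L^m(M)$ is a $\beta$-normal form; (iv) $M$ is $\beta$-normalizable.
   Context: Rigid resource calculus. Rigid resource terms: $a ::= x\mid \lambda x.a\mid \langle c\rangle\vec d\mid 0$, where $\vec d=(d_1,\dots,d_n)$, $n\ge0$, is a finite list of rigid terms; up to $\alpha$-equivalence; $0$ is absorbing ($\lambda x.0=0$, $\langle0\rangle\vec d=0$, a list containing $0$ equals $0$). Rigid substitution $a[\vec b/x]$ with $\vec b=(b_1,\dots,b_k)$: if $x$ has exactly $k$ free occurrences in $a$, replace the $i$-th one (left-to-right) by $b_i$; otherwise $0$. Rigid reduction $\to_r$: contextual closure of $\langle\lambda x.a\rangle\vec b\to_r a[\vec b/x]$; it is confluent and strongly normalizing, and $NF(a)$ is the normal form (a rigid term or $0$). Rigid expansion: $T_r(x)=\{x\}$, $T_r(\lambda x.M)=\{\lambda x.a\mid a\in T_r(M)\}$, $T_r(PQ)=\{\langle c\rangle(d_1,\dots,d_n)\mid c\in T_r(P), n\ge0, d_i\in T_r(Q)\}$. Positive rigid terms: $x$; $\lambda x.a$ with $a$ positive; $\langle c\rangle(d_1,\dots,d_n)$ with $n\ge1$ and $c,d_1,\dots,d_n$ positive ($0$ is not positive). Left-parallel reduction on $\lambda$-terms: $L(M)=M$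 if $M$ is $\beta$-normal; $L(\lambda x_1\dots\lambda x_m.yQ_1\dots Q_n)=\lambda x_1\dots\lambda x_m.yL(Q_1)\dots L(Q_n)$ if $M$ has this head-normal shape but is not $\beta$-normal; $L(\lambda x_1\dots\lambda x_m.(\lambda x.P)QQ_1\dots Q_n)=\lambda x_1\dots\lambda x_m.P[Q/x]Q_1\dots Q_n$. Rigid version: $L_r(a)=a$ if $a$ is $\to_r$-normal (including $0$); $L_r(\lambda x_1\dots\lambda x_m.\langle\cdots\langle y\rangle\vec d_1\cdots\rangle\vec d_n)=\lambda x_1\dots\lambda x_m.\langle\cdots\langle y\rangle L_r(\vec d_1)\cdots\rangle L_r(\vec d_n)$ otherwise, for $y$ a variable, where $L_r$ acts componentwise on lists; and $L_r(\lambda x_1\dots\lambda x_m.\langle\cdots\langle\langle\lambda x.c\rangle\vec d\rangle\vec d_1\cdots\rangle\vec d_n)=\lambda x_1\dots\lambda x_m.\langle\cdots\langle c[\vec d/x]\rangle\vec d_1\cdots\rangle\vec d_n$. -}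

module Defs where

open import Data.Nat using (ℕ; zero; suc; pred; _≤ᵇ_; _<ᵇ_)
open import Data.Bool using (Bool; true; false; if_then_else_)
open import Data.List using (List; []; _∷_)
open import Data.List.Relation.Unary.All using (All)
open import Data.Maybe using (Maybe; just; nothing; _>>=_)
import Data.Maybe as M
open import Data.Product using (_×_; _,_)
open import Data.Unit using (⊤)
open import Relation.Nullary using (¬_)
open import Relation.Binary.Construct.Closure.ReflexiveTransitive using (Star)

-- Untyped λ-terms, de Bruijn indices (α-equivalence = syntactic equality)

data Term : Set where
  var : ℕ → Term
  lam : Term → Term
  app : Term → Term → Term

shift : ℕ → Term → Term
shift c (var x) = if c ≤ᵇ x then var (suc x) else var x
shift c (lam t) = lam (shift (suc c) t)
shift c (app t u) = app (shift c t) (shift c u)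

subst : ℕ → Term → Term → Term
subst k (var x) u = if x <ᵇ k then var x else (if k <ᵇ x then var (pred x) else u)
subst k (lam t) u = lam (subst (suc k) t (shift 0 u))
subst k (app t v) u = app (subst k t u) (subst k v u)

_[_]β : Term → Term → Term
P [ Q ]β = subst 0 P Q

infix 4 _→β_ _→β*_
data _→β_ : Term → Term → Set where
  β    : ∀ {P Q} → app (lam P) Q →β P [ Q ]β
  ξlam : ∀ {P P'} → P →β P' → lam P →β lam P'
  ξl   : ∀ {P P' Q} → P →β P' → app P Q →β app P' Q
  ξr   : ∀ {P Q Q'} → Q →β Q' → app P Q →β app P Q'

_→β*_ : Term → Term → Set
_→β*_ = Star _→β_

βNormal : Term → Set
βNormal M = ∀ N → ¬ (M →β N)

βNormalizable : Term → Set
βNormalizable M = Data.Product.Σ Term (λ N → (M →β* N) × βNormal N)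

headVar : Term → Bool
headVar (var _) = true
headVar (lam _) = false
headVar (app t _) = headVar t

-- Under the spine decomposition
-- λx1..xm. h Q1 .. Qn :  if h is a variable, L maps over the Qi;
-- if h Q1 = (λx.P)Q, the head redex is contracted.
-- (The clause "L(M) = M for β-normal M" is an instance of the variable-head clause.)
L : Term → Term
L (var x) = var x
L (lam t) = lam (L t)
L (app (var x) u) = app (var x) (L u)
L (app (lam t) u) = t [ u ]β
L (app (app t s) u) =
  if headVar t then app (L (app t s)) (L u) else app (L (app t s)) u

Literate : ℕ → Term → Term
Literate zero M = M
Literate (suc m) M = L (Literate m M)

-- Rigid resource terms.  0-free syntax; "rigid term or 0" is Maybe RTerm,
-- with nothing = 0 (absorption of 0 is built in).

data RTerm : Set where
  rvar : ℕ → RTerm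
  rlam : RTerm → RTerm
  rapp : RTerm → List RTerm → RTerm

mutual
  rshift : ℕ → RTerm → RTerm
  rshift c (rvar x) = if c ≤ᵇ x then rvar (suc x) else rvar x
  rshift c (rlam a) = rlam (rshift (suc c) a)
  rshift c (rapp a ds) = rapp (rshift c a) (rshiftL c ds)

  rshiftL : ℕ → List RTerm → List RTerm
  rshiftL c [] = []
  rshiftL c (d ∷ ds) = rshift c d ∷ rshiftL c ds

rshiftN : ℕ → RTerm → RTerm
rshiftN zero b = b
rshiftN (suc n) b = rshift 0 (rshiftN n b)

-- rsub k a bs : replace the occurrences of variable k (k = binders crossed)
-- left-to-right by the elements of bs (consumed in order), decrementing
-- variables above k; returns the unconsumed rest.
mutual
  rsub : ℕ → RTerm → List RTerm → Maybe (RTerm × List RTerm)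
  rsub k (rvar x) bs =
    if x <ᵇ k then just (rvar x , bs)
    else (if k <ᵇ x then just (rvar (pred x) , bs) else pop k bs)
  rsub k (rlam a) bs = rsub (suc k) a bs >>= λ { (a' , bs') → just (rlam a' , bs') }
  rsub k (rapp a ds) bs =
    rsub k a bs >>= λ { (a' , bs1) →
    rsubL k ds bs1 >>= λ { (ds' , bs2) → just (rapp a' ds' , bs2) } }

  rsubL : ℕ → List RTerm → List RTerm → Maybe (List RTerm × List RTerm)
  rsubL k [] bs = just ([] , bs)
  rsubL k (d ∷ ds) bs =
    rsub k d bs >>= λ { (d' , bs1) →
    rsubL k ds bs1 >>= λ { (ds' , bs2) → just (d' ∷ ds' , bs2) } }

  pop : ℕ → List RTerm → Maybe (RTerm × List RTerm)
  pop k [] = nothing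
  pop k (b ∷ bs) = just (rshiftN k b , bs)

-- rigid substitution a[bs/x] for the outermost binder x; 0 (nothing) unless
-- the number of occurrences of x equals the length of bs
finish : Maybe (RTerm × List RTerm) → Maybe RTerm
finish nothing = nothing
finish (just (a , [])) = just a
finish (just (a , _ ∷ _)) = nothing

rsubst : RTerm → List RTerm → Maybe RTerm
rsubst a bs = finish (rsub 0 a bs)

infix 4 _⟶r_ _⟶rL_ _⟶R_ _⟶R*_
mutual
  data _⟶r_ : RTerm → Maybe RTerm → Set where
    rβ    : ∀ {a bs} → rapp (rlam a) bs ⟶r rsubst a bs
    rξlam : ∀ {a r} → a ⟶r r → rlam a ⟶r M.map rlam r
    rξl   : ∀ {a ds r} → a ⟶r r → rapp a ds ⟶r M.map (λ a' → rapp a' ds) r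
    rξr   : ∀ {a ds r} → ds ⟶rL r → rapp a ds ⟶r M.map (rapp a) r

  data _⟶rL_ : List RTerm → Maybe (List RTerm) → Set where
    here  : ∀ {d ds r} → d ⟶r r → (d ∷ ds) ⟶rL M.map (_∷ ds) r
    there : ∀ {d ds r} → ds ⟶rL r → (d ∷ ds) ⟶rL M.map (d ∷_) r

data _⟶R_ : Maybe RTerm → Maybe RTerm → Set where
  lift : ∀ {a r} → a ⟶r r → just a ⟶R r

_⟶R*_ : Maybe RTerm → Maybe RTerm → Set
_⟶R*_ = Star _⟶R_

rNormal : RTerm → Set
rNormal a = ∀ r → ¬ (a ⟶r r)

rNormalM : Maybe RTerm → Set
rNormalM nothing = ⊤
rNormalM (just a) = rNormal a

-- NF(a) ≡ r : r is the (unique, by confluence and SN) →r-normal form of a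
NFis : RTerm → Maybe RTerm → Set
NFis a r = (just a ⟶R* r) × rNormalM r

infix 4 _∈Tr_
data _∈Tr_ : RTerm → Term → Set where
  tvar : ∀ {x} → rvar x ∈Tr var x
  tlam : ∀ {a M} → a ∈Tr M → rlam a ∈Tr lam M
  tapp : ∀ {c ds P Q} → c ∈Tr P → All (_∈Tr Q) ds → rapp c ds ∈Tr app P Q

data Positive : RTerm → Set where
  pvar : ∀ {x} → Positive (rvar x)
  plam : ∀ {a} → Positive a → Positive (rlam a)
  papp : ∀ {c d ds} → Positive c → All Positive (d ∷ ds) → Positive (rapp c (d ∷ ds))

headVarR : RTerm → Bool
headVarR (rvar _) = true
headVarR (rlam _) = false
headVarR (rapp c _) = headVarR c

mutual
  Lr : RTerm → Maybe RTerm
  Lr (rvar x) = just (rvar x)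
  Lr (rlam c) = M.map rlam (Lr c)
  Lr (rapp (rvar x) ds) = M.map (rapp (rvar x)) (LrL ds)
  Lr (rapp (rlam c) ds) = rsubst c ds
  Lr (rapp (rapp c ds1) ds) =
    if headVarR c
    then (Lr (rapp c ds1) >>= λ c' → M.map (rapp c') (LrL ds))
    else M.map (λ c' → rapp c' ds) (Lr (rapp c ds1))

  LrL : List RTerm → Maybe (List RTerm)
  LrL [] = just []
  LrL (d ∷ ds) = Lr d >>= λ d' → M.map (d' ∷_) (LrL ds)

LrM : Maybe RTerm → Maybe RTerm
LrM r = r >>= Lr

LrIterate : ℕ → RTerm → Maybe RTerm
LrIterate zero a = just a
LrIterate (suc m) a = LrM (LrIterate m a)

-- The conditions
-- (i)–(iv) of the theorem (PositiveNF, LrNormalises, LNormalises and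
-- βNormalizable below) are linked by (i) ⇒ WN ⇒ (iii) ⇒ (ii) ⇒ (i) and
-- (iii) ⇒ (iv) ⇒ (i), where WN is inductive normalisation, one rule per clause of L.
--
-- The easy directions are simulations: L and L_r are reduction strategies, which
-- gives (iii) ⇒ (iv) and (ii) ⇒ (i); T_r of the target of an L-step or a β-step is
-- the image of T_r of its source, which pulls the positive normal "full"
-- expansion of a normal form back to M and gives (iii) ⇒ (ii) and (iv) ⇒ (i).
-- The heart is (i) ⇒ WN, by induction on the size of the expansion, which rigid β
-- decreases: the head redex of a reduction to a normal form can be contracted
-- first (postponement), and positivity makes every bag of a variable spine
-- non-empty.  Commuting steps with rigid substitution permutes the bag, so this
-- part uses an order-insensitive substitution `Subst` (with its substitution
-- lemma) and a reduction `_⇝_` that never produces 0.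
module Submission where

open import Defs
open import Data.Nat using (ℕ; zero; suc; pred; _+_; _⊔_; _≤_; _<_; _≤ᵇ_; _<ᵇ_; z≤n; s≤s; z<s)
open import Data.Nat.Properties
open import Data.Bool using (true; false; T; if_then_else_)
open import Data.Unit using (tt)
open import Data.Empty using (⊥; ⊥-elim)
open import Data.List using (List; []; _∷_; _++_; map; [_])
open import Data.List.Properties using (++-assoc; ++-identityʳ; map-++; map-∘; map-id)
open import Data.List.Relation.Unary.All using (All; []; _∷_) renaming (map to All-map)
import Data.List.Relation.Unary.All.Properties as All
open import Data.List.Relation.Unary.Any using (here)
open import Data.List.Relation.Binary.Pointwise using (Pointwise; []; _∷_)
import Data.List.Relation.Binary.Pointwise.Properties as Pointwise
open import Data.List.Relation.Binary.Permutation.Propositional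
  using (_↭_; prep; swap; ↭-refl; ↭-reflexive; ↭-sym; ↭-trans; module PermutationReasoning)
import Data.List.Relation.Binary.Permutation.Propositional.Properties as Perm
open import Data.List.Membership.Propositional.Properties using (∈-++⁻; ∈-∃++)
open import Data.Maybe using (Maybe; just; nothing; _>>=_)
import Data.Maybe as Maybe
open import Data.Product using (Σ; _×_; _,_)
open import Data.Sum using (_⊎_; inj₁; inj₂)
open import Relation.Nullary using (¬_; yes; no)
open import Relation.Binary.Definitions using (tri<; tri≈; tri>)
open import Relation.Binary.PropositionalEquality
  using (_≡_; refl; sym; trans; cong; cong₂; module ≡-Reasoning)
import Relation.Binary.PropositionalEquality as Eq
open import Relation.Binary.Construct.Closure.ReflexiveTransitive
  using (Star; ε; _◅_; _◅◅_; gmap)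
open import Function.Base using (_∘_)
open import Function.Bundles using (_⇔_; mk⇔)
open import Data.Nat.ListAction using (sum)
open import Data.Nat.ListAction.Properties using (sum-++; sum-↭)
open import Algebra.Properties.CommutativeSemigroup +-commutativeSemigroup using (interchange)

PositiveNF : Term → Set
PositiveNF M = Σ RTerm λ a → a ∈Tr M × Σ RTerm λ b → NFis a (just b) × Positive b

LrNormalises : Term → Set
LrNormalises M =
  Σ RTerm λ a → a ∈Tr M × Σ ℕ λ m → Σ RTerm λ b → LrIterate m a ≡ just b × Positive b × rNormal b

LNormalises : Term → Set
LNormalises M = Σ ℕ λ m → βNormal (Literate m M)

≡true : ∀ {b} → T b → b ≡ true
≡true {true} _ = refl

≡false : ∀ {b} → ¬ T b → b ≡ false
≡false {false} _ = refl
≡false {true} ¬t = ⊥-elim (¬t tt)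

≤ᵇ-true : ∀ {m n} → m ≤ n → (m ≤ᵇ n) ≡ true
≤ᵇ-true m≤n = ≡true (≤⇒≤ᵇ m≤n)

≤ᵇ-false : ∀ {m n} → n < m → (m ≤ᵇ n) ≡ false
≤ᵇ-false {m} {n} n<m = ≡false (λ t → <⇒≱ n<m (≤ᵇ⇒≤ m n t))

<ᵇ-true : ∀ {m n} → m < n → (m <ᵇ n) ≡ true
<ᵇ-true m<n = ≡true (<⇒<ᵇ m<n)

<ᵇ-false : ∀ {m n} → n ≤ m → (m <ᵇ n) ≡ false
<ᵇ-false {m} {n} n≤m = ≡false (λ t → ≤⇒≯ n≤m (<ᵇ⇒< m n t))

shift-var-< : ∀ {c x} → x < c → shift c (var x) ≡ var x
shift-var-< x<c rewrite ≤ᵇ-false x<c = refl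

shift-var-≥ : ∀ {c x} → c ≤ x → shift c (var x) ≡ var (suc x)
shift-var-≥ c≤x rewrite ≤ᵇ-true c≤x = refl

rshift-var-< : ∀ {c x} → x < c → rshift c (rvar x) ≡ rvar x
rshift-var-< x<c rewrite ≤ᵇ-false x<c = refl

rshift-var-≥ : ∀ {c x} → c ≤ x → rshift c (rvar x) ≡ rvar (suc x)
rshift-var-≥ c≤x rewrite ≤ᵇ-true c≤x = refl

subst-var-< : ∀ {k x u} → x < k → subst k (var x) u ≡ var x
subst-var-< x<k rewrite <ᵇ-true x<k = refl

subst-var-≡ : ∀ {k u} → subst k (var k) u ≡ u
subst-var-≡ {k} rewrite <ᵇ-false (≤-refl {k}) = refl

subst-var-> : ∀ {k x u} → k < x → subst k (var x) u ≡ var (pred x)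
subst-var-> k<x rewrite <ᵇ-false (<⇒≤ k<x) | <ᵇ-true k<x = refl

rsub-var-< : ∀ {k x bs} → x < k → rsub k (rvar x) bs ≡ just (rvar x , bs)
rsub-var-< x<k rewrite <ᵇ-true x<k = refl

rsub-var-≡ : ∀ {k bs} → rsub k (rvar k) bs ≡ pop k bs
rsub-var-≡ {k} rewrite <ᵇ-false (≤-refl {k}) = refl

rsub-var-> : ∀ {k x bs} → k < x → rsub k (rvar x) bs ≡ just (rvar (pred x) , bs)
rsub-var-> k<x rewrite <ᵇ-false (<⇒≤ k<x) | <ᵇ-true k<x = refl

mutual
  rshift-comm : ∀ i c a → rshift (suc (i + c)) (rshift i a) ≡ rshift i (rshift (i + c) a)
  rshift-comm i c (rvar x) with x <? i | x <? i + c
  ... | yes x<i | _ rewrite rshift-var-< {i + c} (<-≤-trans x<i (m≤m+n i c))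
                          | rshift-var-< {i} x<i
                          | rshift-var-< {suc (i + c)} (<-≤-trans x<i (≤-trans (m≤m+n i c) (n≤1+n _))) = refl
  ... | no x≮i | yes x<i+c rewrite rshift-var-< {i + c} x<i+c
                                 | rshift-var-≥ {i} (≮⇒≥ x≮i)
                                 | rshift-var-< {suc (i + c)} (s≤s x<i+c) = refl
  ... | no x≮i | no x≮i+c rewrite rshift-var-≥ {i + c} (≮⇒≥ x≮i+c)
                                | rshift-var-≥ {i} (≮⇒≥ x≮i)
                                | rshift-var-≥ {i} (m≤n⇒m≤1+n (≮⇒≥ x≮i))
                                | rshift-var-≥ {suc (i + c)} (s≤s (≮⇒≥ x≮i+c)) = refl
  rshift-comm i c (rlam a) = cong rlam (rshift-comm (suc i) c a)
  rshift-comm i c (rapp a ds) = cong₂ rapp (rshift-comm i c a) (rshiftL-comm i c ds)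

  rshiftL-comm : ∀ i c ds → rshiftL (suc (i + c)) (rshiftL i ds) ≡ rshiftL i (rshiftL (i + c) ds)
  rshiftL-comm i c [] = refl
  rshiftL-comm i c (d ∷ ds) = cong₂ _∷_ (rshift-comm i c d) (rshiftL-comm i c ds)

rshift-rshiftN : ∀ j c d → rshift (j + c) (rshiftN j d) ≡ rshiftN j (rshift c d)
rshift-rshiftN zero c d = refl
rshift-rshiftN (suc j) c d =
  trans (rshift-comm 0 (j + c) (rshiftN j d)) (cong (rshift 0) (rshift-rshiftN j c d))

rshift-into-rshiftN : ∀ j n d → j ≤ n → rshift j (rshiftN n d) ≡ rshiftN (suc n) d
rshift-into-rshiftN zero n d _ = refl
rshift-into-rshiftN (suc j) (suc n) d (s≤s j≤n) =
  trans (rshift-comm 0 j (rshiftN n d)) (cong (rshift 0) (rshift-into-rshiftN j n d j≤n))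

rshiftL≡map : ∀ c ds → rshiftL c ds ≡ map (rshift c) ds
rshiftL≡map c [] = refl
rshiftL≡map c (d ∷ ds) = cong (rshift c d ∷_) (rshiftL≡map c ds)

∷≭[] : ∀ {A : Set} {x : A} {xs} → ¬ (x ∷ xs ↭ [])
∷≭[] p with Perm.↭-empty-inv p
... | ()

↭-split : ∀ {A : Set} {x : A} {xs} ys zs → x ∷ xs ↭ ys ++ zs →
  (Σ (List A) λ ys' → ys ↭ x ∷ ys' × xs ↭ ys' ++ zs) ⊎
  (Σ (List A) λ zs' → zs ↭ x ∷ zs' × xs ↭ ys ++ zs')
↭-split {x = x} {xs} ys zs p with ∈-++⁻ ys (Perm.∈-resp-↭ p (here refl))
... | inj₁ x∈ys with ∈-∃++ x∈ys
...   | pre , post , refl = inj₁ (pre ++ post , Perm.shift x pre post , Perm.drop-∷ (↭-trans p moved))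
  where
  open PermutationReasoning
  moved : (pre ++ x ∷ post) ++ zs ↭ x ∷ (pre ++ post) ++ zs
  moved = begin
    (pre ++ x ∷ post) ++ zs  ≡⟨ ++-assoc pre (x ∷ post) zs ⟩
    pre ++ x ∷ post ++ zs    ↭⟨ Perm.shift x pre (post ++ zs) ⟩
    x ∷ pre ++ post ++ zs    ≡⟨ cong (x ∷_) (++-assoc pre post zs) ⟨
    x ∷ (pre ++ post) ++ zs  ∎
↭-split {x = x} {xs} ys zs p | inj₂ x∈zs with ∈-∃++ x∈zs
...   | pre , post , refl = inj₂ (pre ++ post , Perm.shift x pre post , Perm.drop-∷ (↭-trans p moved))
  where
  open PermutationReasoning
  moved : ys ++ pre ++ x ∷ post ↭ x ∷ ys ++ pre ++ post
  moved = begin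
    ys ++ pre ++ x ∷ post  ↭⟨ Perm.++⁺ˡ ys (Perm.shift x pre post) ⟩
    ys ++ x ∷ pre ++ post  ↭⟨ Perm.shift x ys (pre ++ post) ⟩
    x ∷ ys ++ pre ++ post  ∎

↭-interchange : ∀ {A : Set} (a₁ b₁ a₂ b₂ : List A) →
  (a₁ ++ b₁) ++ (a₂ ++ b₂) ↭ (a₁ ++ a₂) ++ (b₁ ++ b₂)
↭-interchange a₁ b₁ a₂ b₂ = begin
  (a₁ ++ b₁) ++ a₂ ++ b₂  ≡⟨ ++-assoc a₁ b₁ (a₂ ++ b₂) ⟩
  a₁ ++ b₁ ++ a₂ ++ b₂    ↭⟨ Perm.++⁺ˡ a₁ (Perm.shifts b₁ a₂) ⟩
  a₁ ++ a₂ ++ b₁ ++ b₂    ≡⟨ ++-assoc a₁ a₂ (b₁ ++ b₂) ⟨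
  (a₁ ++ a₂) ++ b₁ ++ b₂  ∎
  where open PermutationReasoning

-- Order-insensitive rigid substitution.  `Subst k c ds e` says that e is c with
-- the occurrences of the variable k (k = binders crossed) replaced by the terms
-- of the bag ds, each used exactly once and in some order, shifted by k, while
-- the variables above k are decremented.  Exact rigid substitution is the
-- instance that consumes the bag from left to right (rsub-sound below).
mutual
  data Subst : ℕ → RTerm → List RTerm → RTerm → Set where
    sub<    : ∀ {k x ds} → x < k → ds ↭ [] → Subst k (rvar x) ds (rvar x)
    sub≡    : ∀ {k x ds d} → x ≡ k → ds ↭ [ d ] → Subst k (rvar x) ds (rshiftN k d)
    sub>    : ∀ {k x ds} → k < x → ds ↭ [] → Subst k (rvar x) ds (rvar (pred x))
    sublam  : ∀ {k a ds e} → Subst (suc k) a ds e → Subst k (rlam a) ds (rlam e)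
    subapp  : ∀ {k a fs ds ds₁ ds₂ e es} → Subst k a ds₁ e → SubstL k fs ds₂ es →
              ds ↭ ds₁ ++ ds₂ → Subst k (rapp a fs) ds (rapp e es)

  data SubstL : ℕ → List RTerm → List RTerm → List RTerm → Set where
    subnil  : ∀ {k ds} → ds ↭ [] → SubstL k [] ds []
    subcons : ∀ {k f fs ds ds₁ ds₂ e es} → Subst k f ds₁ e → SubstL k fs ds₂ es →
              ds ↭ ds₁ ++ ds₂ → SubstL k (f ∷ fs) ds (e ∷ es)

Subst-resp-↭ : ∀ {k c ds ds' e} → Subst k c ds e → ds' ↭ ds → Subst k c ds' e
Subst-resp-↭ (sub< x<k q) p = sub< x<k (↭-trans p q)
Subst-resp-↭ (sub≡ x≡k q) p = sub≡ x≡k (↭-trans p q)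
Subst-resp-↭ (sub> k<x q) p = sub> k<x (↭-trans p q)
Subst-resp-↭ (sublam s) p = sublam (Subst-resp-↭ s p)
Subst-resp-↭ (subapp s ss q) p = subapp s ss (↭-trans p q)

SubstL-resp-↭ : ∀ {k cs ds ds' es} → SubstL k cs ds es → ds' ↭ ds → SubstL k cs ds' es
SubstL-resp-↭ (subnil q) p = subnil (↭-trans p q)
SubstL-resp-↭ (subcons s ss q) p = subcons s ss (↭-trans p q)

Subst-cast : ∀ {k a a' ds e e'} → a ≡ a' → e ≡ e' → Subst k a ds e → Subst k a' ds e'
Subst-cast refl refl s = s

-- Rigid reduction that never produces 0: its β-rule is `Subst`, so a step is
-- available only when the bag fits the occurrences exactly, in any order.
infix 4 _⇝_ _⇝L_ _⇝*_
mutual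
  data _⇝_ : RTerm → RTerm → Set where
    ⇝β   : ∀ {f fs e} → Subst 0 f fs e → rapp (rlam f) fs ⇝ e
    ⇝lam : ∀ {a a'} → a ⇝ a' → rlam a ⇝ rlam a'
    ⇝fun : ∀ {a a' ds} → a ⇝ a' → rapp a ds ⇝ rapp a' ds
    ⇝arg : ∀ {a ds ds'} → ds ⇝L ds' → rapp a ds ⇝ rapp a ds'

  data _⇝L_ : List RTerm → List RTerm → Set where
    ⇝here  : ∀ {d d' ds} → d ⇝ d' → (d ∷ ds) ⇝L (d' ∷ ds)
    ⇝there : ∀ {d ds ds'} → ds ⇝L ds' → (d ∷ ds) ⇝L (d ∷ ds')

_⇝*_ : RTerm → RTerm → Set
_⇝*_ = Star _⇝_

bind-just : ∀ {A B : Set} (m : Maybe A) {f : A → Maybe B} {y} →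
  (m >>= f) ≡ just y → Σ A λ x → m ≡ just x × f x ≡ just y
bind-just (just x) eq = x , refl , eq

mutual
  rsub-sound : ∀ k c bs {e rest} → rsub k c bs ≡ just (e , rest) →
    Σ (List RTerm) λ ds → bs ≡ ds ++ rest × Subst k c ds e
  rsub-sound k (rvar x) bs eq with <-cmp x k
  ... | tri< x<k _ _ with trans (sym (rsub-var-< x<k)) eq
  ...   | refl = [] , refl , sub< x<k ↭-refl
  rsub-sound k (rvar x) bs eq | tri> _ _ k<x with trans (sym (rsub-var-> k<x)) eq
  ...   | refl = [] , refl , sub> k<x ↭-refl
  rsub-sound k (rvar x) (b ∷ bs) eq | tri≈ _ refl _ with trans (sym (rsub-var-≡ {k} {b ∷ bs})) eq
  ...   | refl = [ b ] , refl , sub≡ refl ↭-refl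
  rsub-sound k (rvar x) [] eq | tri≈ _ refl _ with trans (sym (rsub-var-≡ {k} {[]})) eq
  ...   | ()
  rsub-sound k (rlam a) bs eq with bind-just (rsub (suc k) a bs) eq
  ... | _ , eq₁ , refl with rsub-sound (suc k) a bs eq₁
  ...   | ds , bs≡ , s = ds , bs≡ , sublam s
  rsub-sound k (rapp a fs) bs eq with bind-just (rsub k a bs) eq
  ... | (_ , bs₁) , eq₁ , eq′ with bind-just (rsubL k fs bs₁) eq′
  ...   | _ , eq₂ , refl with rsub-sound k a bs eq₁ | rsubL-sound k fs bs₁ eq₂
  ...     | ds₁ , refl , s | ds₂ , refl , ss = ds₁ ++ ds₂ , sym (++-assoc ds₁ ds₂ _) , subapp s ss ↭-refl

  rsubL-sound : ∀ k cs bs {es rest} → rsubL k cs bs ≡ just (es , rest) →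
    Σ (List RTerm) λ ds → bs ≡ ds ++ rest × SubstL k cs ds es
  rsubL-sound k [] bs refl = [] , refl , subnil ↭-refl
  rsubL-sound k (c ∷ cs) bs eq with bind-just (rsub k c bs) eq
  ... | (_ , bs₁) , eq₁ , eq′ with bind-just (rsubL k cs bs₁) eq′
  ...   | _ , eq₂ , refl with rsub-sound k c bs eq₁ | rsubL-sound k cs bs₁ eq₂
  ...     | ds₁ , refl , s | ds₂ , refl , ss = ds₁ ++ ds₂ , sym (++-assoc ds₁ ds₂ _) , subcons s ss ↭-refl

rsubst-sound : ∀ c ds {e} → rsubst c ds ≡ just e → Subst 0 c ds e
rsubst-sound c ds eq with rsub 0 c ds in eq₁
rsubst-sound c ds refl | just (e , []) with rsub-sound 0 c ds eq₁
... | ds' , ds≡ , s = Subst-resp-↭ s (↭-reflexive (trans ds≡ (++-identityʳ ds')))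

shiftN : ℕ → Term → Term
shiftN zero Q = Q
shiftN (suc n) Q = shift 0 (shiftN n Q)

mutual
  rshift-∈Tr : ∀ c {d Q} → d ∈Tr Q → rshift c d ∈Tr shift c Q
  rshift-∈Tr c (tvar {x}) with c ≤ᵇ x
  ... | true = tvar
  ... | false = tvar
  rshift-∈Tr c (tlam t) = tlam (rshift-∈Tr (suc c) t)
  rshift-∈Tr c (tapp t ts) = tapp (rshift-∈Tr c t) (rshiftL-∈Tr c ts)

  rshiftL-∈Tr : ∀ c {ds Q} → All (_∈Tr Q) ds → All (_∈Tr shift c Q) (rshiftL c ds)
  rshiftL-∈Tr c [] = []
  rshiftL-∈Tr c (t ∷ ts) = rshift-∈Tr c t ∷ rshiftL-∈Tr c ts

rshiftN-∈Tr : ∀ n {d Q} → d ∈Tr Q → rshiftN n d ∈Tr shiftN n Q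
rshiftN-∈Tr zero t = t
rshiftN-∈Tr (suc n) t = rshift-∈Tr 0 (rshiftN-∈Tr n t)

mutual
  rshift-∈Tr⁻ : ∀ c Q {b} → b ∈Tr shift c Q → Σ RTerm λ d → d ∈Tr Q × rshift c d ≡ b
  rshift-∈Tr⁻ c (var x) t with x <? c
  ... | yes x<c rewrite shift-var-< x<c with t
  ...   | tvar = rvar x , tvar , rshift-var-< x<c
  rshift-∈Tr⁻ c (var x) t | no x≮c rewrite shift-var-≥ (≮⇒≥ x≮c) with t
  ...   | tvar = rvar x , tvar , rshift-var-≥ (≮⇒≥ x≮c)
  rshift-∈Tr⁻ c (lam Q) (tlam t) with rshift-∈Tr⁻ (suc c) Q t
  ... | d , td , refl = rlam d , tlam td , refl
  rshift-∈Tr⁻ c (app P Q) (tapp t ts) with rshift-∈Tr⁻ c P t | rshiftL-∈Tr⁻ c Q ts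
  ... | d , td , refl | ds , tds , refl = rapp d ds , tapp td tds , refl

  rshiftL-∈Tr⁻ : ∀ c Q {bs} → All (_∈Tr shift c Q) bs →
    Σ (List RTerm) λ ds → All (_∈Tr Q) ds × rshiftL c ds ≡ bs
  rshiftL-∈Tr⁻ c Q [] = [] , [] , refl
  rshiftL-∈Tr⁻ c Q (t ∷ ts) with rshift-∈Tr⁻ c Q t | rshiftL-∈Tr⁻ c Q ts
  ... | d , td , refl | ds , tds , refl = d ∷ ds , td ∷ tds , refl

rshiftN-∈Tr⁻ : ∀ n Q {b} → b ∈Tr shiftN n Q → Σ RTerm λ d → d ∈Tr Q × rshiftN n d ≡ b
rshiftN-∈Tr⁻ zero Q t = _ , t , refl
rshiftN-∈Tr⁻ (suc n) Q t with rshift-∈Tr⁻ 0 (shiftN n Q) t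
... | _ , t′ , refl with rshiftN-∈Tr⁻ n Q t′
...   | d , td , refl = d , td , refl

mutual
  Subst-∈Tr : ∀ {k c ds e P Q} → Subst k c ds e → c ∈Tr P → All (_∈Tr Q) ds →
    e ∈Tr subst k P (shiftN k Q)
  Subst-∈Tr {k} {Q = Q} (sub< {x = x} x<k _) tvar _ rewrite subst-var-< {k} {x} {shiftN k Q} x<k = tvar
  Subst-∈Tr {k} {Q = Q} (sub≡ refl q) tvar ts with Perm.All-resp-↭ q ts
  ... | t ∷ [] rewrite subst-var-≡ {k} {shiftN k Q} = rshiftN-∈Tr k t
  Subst-∈Tr {k} {Q = Q} (sub> {x = x} k<x _) tvar _ rewrite subst-var-> {k} {x} {shiftN k Q} k<x = tvar
  Subst-∈Tr (sublam s) (tlam t) ts = tlam (Subst-∈Tr s t ts)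
  Subst-∈Tr (subapp {ds₁ = ds₁} s ss q) (tapp t tfs) ts with All.++⁻ ds₁ (Perm.All-resp-↭ q ts)
  ... | ts₁ , ts₂ = tapp (Subst-∈Tr s t ts₁) (SubstL-∈Tr ss tfs ts₂)

  SubstL-∈Tr : ∀ {k fs ds es P Q} → SubstL k fs ds es → All (_∈Tr P) fs → All (_∈Tr Q) ds →
    All (_∈Tr subst k P (shiftN k Q)) es
  SubstL-∈Tr (subnil _) [] _ = []
  SubstL-∈Tr (subcons {ds₁ = ds₁} s ss q) (t ∷ tfs) ts with All.++⁻ ds₁ (Perm.All-resp-↭ q ts)
  ... | ts₁ , ts₂ = Subst-∈Tr s t ts₁ ∷ SubstL-∈Tr ss tfs ts₂

mutual
  subst-∈Tr⁻ : ∀ k P Q {b} → b ∈Tr subst k P (shiftN k Q) →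
    Σ RTerm λ c → Σ (List RTerm) λ ds → c ∈Tr P × All (_∈Tr Q) ds ×
      (∀ rest → rsub k c (ds ++ rest) ≡ just (b , rest))
  subst-∈Tr⁻ k (var x) Q t with <-cmp x k
  ... | tri< x<k _ _ rewrite subst-var-< {k} {x} {shiftN k Q} x<k with t
  ...   | tvar = rvar x , [] , tvar , [] , λ _ → rsub-var-< x<k
  subst-∈Tr⁻ k (var x) Q t | tri> _ _ k<x rewrite subst-var-> {k} {x} {shiftN k Q} k<x with t
  ...   | tvar = rvar x , [] , tvar , [] , λ _ → rsub-var-> k<x
  subst-∈Tr⁻ k (var x) Q t | tri≈ _ refl _ rewrite subst-var-≡ {k} {shiftN k Q} with rshiftN-∈Tr⁻ k Q t
  ...   | d , td , refl = rvar k , [ d ] , tvar , td ∷ [] , λ rest → rsub-var-≡ {k} {d ∷ rest}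
  subst-∈Tr⁻ k (lam P) Q (tlam t) with subst-∈Tr⁻ (suc k) P Q t
  ... | c , ds , tc , tds , eq = rlam c , ds , tlam tc , tds , λ rest → cong (_>>= _) (eq rest)
  subst-∈Tr⁻ k (app P₁ P₂) Q (tapp t ts) with subst-∈Tr⁻ k P₁ Q t | substL-∈Tr⁻ k P₂ Q ts
  ... | c , ds₁ , tc , tds₁ , eq₁ | cs , ds₂ , tcs , tds₂ , eq₂ =
    rapp c cs , ds₁ ++ ds₂ , tapp tc tcs , All.++⁺ tds₁ tds₂ , consumed
    where
    consumed : ∀ rest → rsub k (rapp c cs) ((ds₁ ++ ds₂) ++ rest) ≡ just (_ , rest)
    consumed rest rewrite ++-assoc ds₁ ds₂ rest | eq₁ (ds₂ ++ rest) | eq₂ rest = refl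

  substL-∈Tr⁻ : ∀ k P Q {bs} → All (_∈Tr subst k P (shiftN k Q)) bs →
    Σ (List RTerm) λ cs → Σ (List RTerm) λ ds → All (_∈Tr P) cs × All (_∈Tr Q) ds ×
      (∀ rest → rsubL k cs (ds ++ rest) ≡ just (bs , rest))
  substL-∈Tr⁻ k P Q [] = [] , [] , [] , [] , λ _ → refl
  substL-∈Tr⁻ k P Q (t ∷ ts) with subst-∈Tr⁻ k P Q t | substL-∈Tr⁻ k P Q ts
  ... | c , ds₁ , tc , tds₁ , eq₁ | cs , ds₂ , tcs , tds₂ , eq₂ =
    c ∷ cs , ds₁ ++ ds₂ , tc ∷ tcs , All.++⁺ tds₁ tds₂ , consumed
    where
    consumed : ∀ rest → rsubL k (c ∷ cs) ((ds₁ ++ ds₂) ++ rest) ≡ just (_ , rest)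
    consumed rest rewrite ++-assoc ds₁ ds₂ rest | eq₁ (ds₂ ++ rest) | eq₂ rest = refl

β-∈Tr⁻ : ∀ P Q {b} → b ∈Tr P [ Q ]β →
  Σ RTerm λ c → Σ (List RTerm) λ ds → c ∈Tr P × All (_∈Tr Q) ds × rsubst c ds ≡ just b
β-∈Tr⁻ P Q t with subst-∈Tr⁻ 0 P Q t
... | c , ds , tc , tds , eq =
  c , ds , tc , tds , cong finish (trans (cong (rsub 0 c) (sym (++-identityʳ ds))) (eq []))

mutual
  Subst-rshift : ∀ {j f fs e} → Subst j f fs e → ∀ c →
    Subst j (rshift (suc j + c) f) (map (rshift c) fs) (rshift (j + c) e)
  Subst-rshift {j} (sub< x<j q) c =
    Subst-cast (sym (rshift-var-< (<-≤-trans x<j (≤-trans (m≤m+n j c) (n≤1+n _)))))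
               (sym (rshift-var-< (<-≤-trans x<j (m≤m+n j c))))
               (sub< x<j (Perm.map⁺ (rshift c) q))
  Subst-rshift {j} (sub≡ {d = d} refl q) c =
    Subst-cast (sym (rshift-var-< (s≤s (m≤m+n j c)))) (sym (rshift-rshiftN j c d))
               (sub≡ refl (Perm.map⁺ (rshift c) q))
  Subst-rshift {j} (sub> {x = suc y} (s≤s j≤y) q) c with y <? j + c
  ... | yes y<j+c =
    Subst-cast (sym (rshift-var-< (s≤s y<j+c))) (sym (rshift-var-< y<j+c))
               (sub> (s≤s j≤y) (Perm.map⁺ (rshift c) q))
  ... | no y≮j+c =
    Subst-cast (sym (rshift-var-≥ (s≤s (≮⇒≥ y≮j+c)))) (sym (rshift-var-≥ (≮⇒≥ y≮j+c)))
               (sub> (s≤s (m≤n⇒m≤1+n j≤y)) (Perm.map⁺ (rshift c) q))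
  Subst-rshift (sublam s) c = sublam (Subst-rshift s c)
  Subst-rshift (subapp {ds₁ = ds₁} {ds₂} s ss q) c =
    subapp (Subst-rshift s c) (SubstL-rshift ss c)
           (↭-trans (Perm.map⁺ (rshift c) q) (↭-reflexive (map-++ (rshift c) ds₁ ds₂)))

  SubstL-rshift : ∀ {j fs ds es} → SubstL j fs ds es → ∀ c →
    SubstL j (rshiftL (suc j + c) fs) (map (rshift c) ds) (rshiftL (j + c) es)
  SubstL-rshift (subnil q) c = subnil (Perm.map⁺ (rshift c) q)
  SubstL-rshift (subcons {ds₁ = ds₁} {ds₂} s ss q) c =
    subcons (Subst-rshift s c) (SubstL-rshift ss c)
            (↭-trans (Perm.map⁺ (rshift c) q) (↭-reflexive (map-++ (rshift c) ds₁ ds₂)))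

mutual
  Subst-rshift-cancel : ∀ j a → Subst j (rshift j a) [] a
  Subst-rshift-cancel j (rvar x) with x <? j
  ... | yes x<j = Subst-cast (sym (rshift-var-< x<j)) refl (sub< x<j ↭-refl)
  ... | no x≮j = Subst-cast (sym (rshift-var-≥ (≮⇒≥ x≮j))) refl (sub> (s≤s (≮⇒≥ x≮j)) ↭-refl)
  Subst-rshift-cancel j (rlam a) = sublam (Subst-rshift-cancel (suc j) a)
  Subst-rshift-cancel j (rapp a ds) = subapp (Subst-rshift-cancel j a) (SubstL-rshift-cancel j ds) ↭-refl

  SubstL-rshift-cancel : ∀ j ds → SubstL j (rshiftL j ds) [] ds
  SubstL-rshift-cancel j [] = subnil ↭-refl
  SubstL-rshift-cancel j (d ∷ ds) = subcons (Subst-rshift-cancel j d) (SubstL-rshift-cancel j ds) ↭-refl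

mutual
  Subst-under-rshift : ∀ i m g {ds e} → Subst (i + suc m) (rshift i g) ds e →
    Σ RTerm λ e′ → Subst (i + m) g ds e′ × e ≡ rshift i e′
  Subst-under-rshift i m (rvar x) s with x <? i
  Subst-under-rshift i m (rvar x) s | yes x<i with Eq.subst (λ a → Subst _ a _ _) (rshift-var-< x<i) s
  ... | sub< _ q = rvar x , sub< (<-≤-trans x<i (m≤m+n i m)) q , sym (rshift-var-< x<i)
  ... | sub≡ x≡ _ = ⊥-elim (<-irrefl x≡ (<-≤-trans x<i (m≤m+n i (suc m))))
  ... | sub> x> _ = ⊥-elim (<-asym (<-≤-trans x<i (m≤m+n i (suc m))) x>)
  Subst-under-rshift i m (rvar x) s | no x≮i with Eq.subst (λ a → Subst _ a _ _) (rshift-var-≥ (≮⇒≥ x≮i)) s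
  ... | sub< x< q = rvar x , sub< (≤-pred (≤-trans x< (≤-reflexive (+-suc i m)))) q , sym (rshift-var-≥ (≮⇒≥ x≮i))
  ... | sub≡ {d = d} x≡ q =
    rshiftN (i + m) d , sub≡ (suc-injective (trans x≡ (+-suc i m))) q ,
    trans (cong (λ n → rshiftN n d) (+-suc i m)) (sym (rshift-into-rshiftN i (i + m) d (m≤m+n i m)))
  ... | sub> x> q with Eq.subst (_< suc x) (+-suc i m) x>
  ...   | s≤s {n = suc z} i+m<x = rvar z , sub> i+m<x q , sym (rshift-var-≥ (≤-trans (m≤m+n i m) (≤-pred i+m<x)))
  Subst-under-rshift i m (rlam g) (sublam s) with Subst-under-rshift (suc i) m g s
  ... | e′ , s′ , refl = rlam e′ , sublam s′ , refl
  Subst-under-rshift i m (rapp g gs) (subapp s ss q) with Subst-under-rshift i m g s | SubstL-under-rshift i m gs ss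
  ... | e′ , s′ , refl | es′ , ss′ , refl = rapp e′ es′ , subapp s′ ss′ q , refl

  SubstL-under-rshift : ∀ i m gs {ds es} → SubstL (i + suc m) (rshiftL i gs) ds es →
    Σ (List RTerm) λ es′ → SubstL (i + m) gs ds es′ × es ≡ rshiftL i es′
  SubstL-under-rshift i m [] (subnil q) = [] , subnil q , refl
  SubstL-under-rshift i m (g ∷ gs) (subcons s ss q) with Subst-under-rshift i m g s | SubstL-under-rshift i m gs ss
  ... | e′ , s′ , refl | es′ , ss′ , refl = e′ ∷ es′ , subcons s′ ss′ q , refl

Subst-under-rshiftN : ∀ j k g {ds e} → Subst (j + k) (rshiftN j g) ds e →
  Σ RTerm λ e′ → Subst k g ds e′ × e ≡ rshiftN j e′
Subst-under-rshiftN zero k g s = _ , s , refl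
Subst-under-rshiftN (suc j) k g s with Subst-under-rshift 0 (j + k) (rshiftN j g) s
... | _ , s₁ , refl with Subst-under-rshiftN j k g s₁
...   | e′ , s′ , refl = e′ , s′ , refl

SubstL-++ : ∀ {k xs xs′ ds ds′ ys ys′} → SubstL k xs ds ys → SubstL k xs′ ds′ ys′ →
  SubstL k (xs ++ xs′) (ds ++ ds′) (ys ++ ys′)
SubstL-++ {ds′ = ds′} (subnil q) t = SubstL-resp-↭ t (Perm.++⁺ʳ ds′ q)
SubstL-++ {ds′ = ds′} (subcons {ds₁ = ds₁} {ds₂} s ss q) t =
  subcons s (SubstL-++ ss t) (↭-trans (Perm.++⁺ʳ ds′ q) (↭-reflexive (++-assoc ds₁ ds₂ ds′)))

SubstL-permute : ∀ {k xs xs′ ds ys} → SubstL k xs ds ys → xs′ ↭ xs →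
  Σ (List RTerm) λ ys′ → ys′ ↭ ys × SubstL k xs′ ds ys′
SubstL-permute s _↭_.refl = _ , ↭-refl , s
SubstL-permute (subcons s ss q) (prep _ p) with SubstL-permute ss p
... | ys′ , r , ss′ = _ , prep _ r , subcons s ss′ q
SubstL-permute (subcons {ds₁ = dy} sy (subcons {ds₁ = dx} sx ss q₂) q₁) (swap _ _ p) with SubstL-permute ss p
... | ys′ , r , ss′ =
  _ , swap _ _ r , subcons sx (subcons sy ss′ ↭-refl) (↭-trans q₁ (↭-trans (Perm.++⁺ˡ dy q₂) (Perm.shifts dy dx)))
SubstL-permute s (_↭_.trans p₁ p₂) with SubstL-permute s p₂
... | _ , r₂ , s₂ with SubstL-permute s₂ p₁
...   | ys′ , r₁ , s₁ = ys′ , ↭-trans r₁ r₂ , s₁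

-- The substitution lemma for rigid terms, up to permutation of bags:
-- f[fs/j][ds/j+k] = f[dsᶠ/j+1+k][fs[dsᵃ/k]/j], where ds splits into the part
-- dsᶠ landing in f and the part dsᵃ landing in the arguments fs.
Composite : ℕ → ℕ → RTerm → List RTerm → List RTerm → RTerm → Set
Composite j k f fs ds e =
  Σ (List RTerm) λ dsᶠ → Σ (List RTerm) λ dsᵃ → Σ RTerm λ f′ → Σ (List RTerm) λ fs′ →
    ds ↭ dsᶠ ++ dsᵃ × Subst (j + suc k) f dsᶠ f′ × SubstL k fs dsᵃ fs′ × Subst j f′ fs′ e

CompositeL : ℕ → ℕ → List RTerm → List RTerm → List RTerm → List RTerm → Set
CompositeL j k hs fs ds es =
  Σ (List RTerm) λ dsᶠ → Σ (List RTerm) λ dsᵃ → Σ (List RTerm) λ hs′ → Σ (List RTerm) λ fs′ →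
    ds ↭ dsᶠ ++ dsᵃ × SubstL (j + suc k) hs dsᶠ hs′ × SubstL k fs dsᵃ fs′ × SubstL j hs′ fs′ es

Subst-compose-var : ∀ j k {x fs c ds e} → Subst j (rvar x) fs c → Subst (j + k) c ds e →
  Composite j k (rvar x) fs ds e
Subst-compose-var j k (sub< x<j q) s₂ with Perm.↭-empty-inv q
Subst-compose-var j k (sub< {x = x} x<j _) (sub< _ q′) | refl =
  [] , [] , rvar x , [] , q′ , sub< (<-≤-trans x<j (m≤m+n j (suc k))) ↭-refl , subnil ↭-refl , sub< x<j ↭-refl
Subst-compose-var j k (sub< x<j _) (sub≡ x≡ _) | refl = ⊥-elim (<-irrefl x≡ (<-≤-trans x<j (m≤m+n j k)))
Subst-compose-var j k (sub< x<j _) (sub> x> _) | refl = ⊥-elim (<-asym x> (<-≤-trans x<j (m≤m+n j k)))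
Subst-compose-var j k {ds = ds} (sub≡ {d = g} refl q) s₂ with Perm.↭-singleton-inv q | Subst-under-rshiftN j k g s₂
... | refl | e′ , s′ , refl =
  [] , ds , rvar j , [ e′ ] , ↭-refl , sub< (m<m+n j z<s) ↭-refl ,
  subcons s′ (subnil ↭-refl) (↭-reflexive (sym (++-identityʳ ds))) , sub≡ refl ↭-refl
Subst-compose-var j k (sub> {x = suc y} (s≤s j≤y) q) s₂ with Perm.↭-empty-inv q
Subst-compose-var j k (sub> {x = suc y} (s≤s j≤y) _) (sub< y< q′) | refl =
  [] , [] , rvar (suc y) , [] , q′ , sub< (Eq.subst (suc y <_) (sym (+-suc j k)) (s≤s y<)) ↭-refl ,
  subnil ↭-refl , sub> (s≤s j≤y) ↭-refl
Subst-compose-var j k (sub> {x = suc y} (s≤s j≤y) _) (sub≡ {d = d} refl q′) | refl =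
  [ d ] , [] , rshiftN (j + suc k) d , [] , q′ , sub≡ (sym (+-suc j k)) ↭-refl , subnil ↭-refl ,
  Subst-cast (trans (rshift-into-rshiftN j (j + k) d (m≤m+n j k)) (cong (λ n → rshiftN n d) (sym (+-suc j k))))
             refl (Subst-rshift-cancel j (rshiftN (j + k) d))
Subst-compose-var j k (sub> {x = suc y} (s≤s j≤y) _) (sub> y> q′) | refl =
  [] , [] , rvar y , [] , q′ , sub> (Eq.subst (_< suc y) (sym (+-suc j k)) (s≤s y>)) ↭-refl ,
  subnil ↭-refl , sub> (≤-<-trans (m≤m+n j k) y>) ↭-refl

reassemble : ∀ {k fs fs₁ fs₂ ds ds₁ ds₂ a₁ b₁ a₂ b₂ ys₁ ys₂} →
  fs ↭ fs₁ ++ fs₂ → ds ↭ ds₁ ++ ds₂ → ds₁ ↭ a₁ ++ b₁ → ds₂ ↭ a₂ ++ b₂ →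
  SubstL k fs₁ b₁ ys₁ → SubstL k fs₂ b₂ ys₂ →
  ds ↭ (a₁ ++ a₂) ++ (b₁ ++ b₂) × Σ (List RTerm) λ ys → SubstL k fs (b₁ ++ b₂) ys × ys ↭ ys₁ ++ ys₂
reassemble {a₁ = a₁} {b₁} {a₂} {b₂} q q₂ r₁ r₂ s₁ s₂ with SubstL-permute (SubstL-++ s₁ s₂) q
... | ys , ys↭ , s =
  ↭-trans q₂ (↭-trans (Perm.++⁺ r₁ r₂) (↭-interchange a₁ b₁ a₂ b₂)) , ys , s , ys↭

mutual
  Subst-compose : ∀ j k {f fs c ds e} → Subst j f fs c → Subst (j + k) c ds e → Composite j k f fs ds e
  Subst-compose j k s@(sub< _ _) s₂ = Subst-compose-var j k s s₂
  Subst-compose j k s@(sub≡ _ _) s₂ = Subst-compose-var j k s s₂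
  Subst-compose j k s@(sub> _ _) s₂ = Subst-compose-var j k s s₂
  Subst-compose j k (sublam s) (sublam s₂) with Subst-compose (suc j) k s s₂
  ... | dsᶠ , dsᵃ , f′ , fs′ , r , sf , sfs , se = dsᶠ , dsᵃ , rlam f′ , fs′ , r , sublam sf , sfs , sublam se
  Subst-compose j k (subapp s ss q) (subapp s₂ ss₂ q₂) with Subst-compose j k s s₂ | SubstL-compose j k ss ss₂
  ... | a₁ , b₁ , g′ , ys₁ , r₁ , sg , sy₁ , sg′ | a₂ , b₂ , hs′ , ys₂ , r₂ , shs , sy₂ , shs′
    with reassemble q q₂ r₁ r₂ sy₁ sy₂
  ...   | r , ys , sy , ys↭ = a₁ ++ a₂ , b₁ ++ b₂ , rapp g′ hs′ , ys , r , subapp sg shs ↭-refl , sy , subapp sg′ shs′ ys↭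

  SubstL-compose : ∀ j k {hs fs cs ds es} → SubstL j hs fs cs → SubstL (j + k) cs ds es → CompositeL j k hs fs ds es
  SubstL-compose j k (subnil q) (subnil q₂) with Perm.↭-empty-inv q
  ... | refl = [] , [] , [] , [] , q₂ , subnil ↭-refl , subnil ↭-refl , subnil ↭-refl
  SubstL-compose j k (subcons s ss q) (subcons s₂ ss₂ q₂) with Subst-compose j k s s₂ | SubstL-compose j k ss ss₂
  ... | a₁ , b₁ , g′ , ys₁ , r₁ , sg , sy₁ , sg′ | a₂ , b₂ , hs′ , ys₂ , r₂ , shs , sy₂ , shs′
    with reassemble q q₂ r₁ r₂ sy₁ sy₂
  ...   | r , ys , sy , ys↭ = a₁ ++ a₂ , b₁ ++ b₂ , g′ ∷ hs′ , ys , r , subcons sg shs ↭-refl , sy , subcons sg′ shs′ ys↭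

mutual
  ⇝-rshift : ∀ c {a a′} → a ⇝ a′ → rshift c a ⇝ rshift c a′
  ⇝-rshift c (⇝β {f} {fs} s) =
    ⇝β (Eq.subst (λ l → Subst 0 (rshift (suc c) f) l _) (sym (rshiftL≡map c fs)) (Subst-rshift s c))
  ⇝-rshift c (⇝lam st) = ⇝lam (⇝-rshift (suc c) st)
  ⇝-rshift c (⇝fun st) = ⇝fun (⇝-rshift c st)
  ⇝-rshift c (⇝arg st) = ⇝arg (⇝L-rshift c st)

  ⇝L-rshift : ∀ c {ds ds′} → ds ⇝L ds′ → rshiftL c ds ⇝L rshiftL c ds′
  ⇝L-rshift c (⇝here st) = ⇝here (⇝-rshift c st)
  ⇝L-rshift c (⇝there st) = ⇝there (⇝L-rshift c st)

⇝-rshiftN : ∀ n {a a′} → a ⇝ a′ → rshiftN n a ⇝ rshiftN n a′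
⇝-rshiftN zero st = st
⇝-rshiftN (suc n) st = ⇝-rshift 0 (⇝-rshiftN n st)

mutual
  Subst-bag-step : ∀ {k c d d₁ rest e} → Subst k c (d₁ ∷ rest) e → d ⇝ d₁ →
    Σ RTerm λ e₀ → Subst k c (d ∷ rest) e₀ × e₀ ⇝ e
  Subst-bag-step (sub< _ q) st = ⊥-elim (∷≭[] q)
  Subst-bag-step {k} {d = d} (sub≡ x≡k q) st with Perm.↭-singleton-inv q
  ... | refl = rshiftN k d , sub≡ x≡k ↭-refl , ⇝-rshiftN k st
  Subst-bag-step (sub> _ q) st = ⊥-elim (∷≭[] q)
  Subst-bag-step (sublam s) st with Subst-bag-step s st
  ... | e₀ , s′ , st′ = rlam e₀ , sublam s′ , ⇝lam st′
  Subst-bag-step {d = d} (subapp {ds₁ = ds₁} {ds₂} s ss q) st with ↭-split ds₁ ds₂ q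
  ... | inj₁ (ds₁′ , p₁ , p₂) with Subst-bag-step (Subst-resp-↭ s (↭-sym p₁)) st
  ...   | e₀ , s′ , st′ = rapp e₀ _ , subapp s′ ss (prep d p₂) , ⇝fun st′
  Subst-bag-step {d = d} (subapp {ds₁ = ds₁} {ds₂} s ss q) st | inj₂ (ds₂′ , p₁ , p₂)
    with SubstL-bag-step (SubstL-resp-↭ ss (↭-sym p₁)) st
  ...   | es₀ , ss′ , st′ = rapp _ es₀ , subapp s ss′ (↭-trans (prep d p₂) (↭-sym (Perm.shift d ds₁ ds₂′))) , ⇝arg st′

  SubstL-bag-step : ∀ {k cs d d₁ rest es} → SubstL k cs (d₁ ∷ rest) es → d ⇝ d₁ →
    Σ (List RTerm) λ es₀ → SubstL k cs (d ∷ rest) es₀ × es₀ ⇝L es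
  SubstL-bag-step (subnil q) st = ⊥-elim (∷≭[] q)
  SubstL-bag-step {d = d} (subcons {ds₁ = ds₁} {ds₂} s ss q) st with ↭-split ds₁ ds₂ q
  ... | inj₁ (ds₁′ , p₁ , p₂) with Subst-bag-step (Subst-resp-↭ s (↭-sym p₁)) st
  ...   | e₀ , s′ , st′ = e₀ ∷ _ , subcons s′ ss (prep d p₂) , ⇝here st′
  SubstL-bag-step {d = d} (subcons {ds₁ = ds₁} {ds₂} s ss q) st | inj₂ (ds₂′ , p₁ , p₂)
    with SubstL-bag-step (SubstL-resp-↭ ss (↭-sym p₁)) st
  ...   | es₀ , ss′ , st′ = _ ∷ es₀ , subcons s ss′ (↭-trans (prep d p₂) (↭-sym (Perm.shift d ds₁ ds₂′))) , ⇝there st′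

⇝L-position : ∀ {ds ds₁} → ds ⇝L ds₁ →
  Σ (List RTerm) λ pre → Σ (List RTerm) λ post → Σ RTerm λ d → Σ RTerm λ d₁ →
    ds ≡ pre ++ d ∷ post × ds₁ ≡ pre ++ d₁ ∷ post × d ⇝ d₁
⇝L-position (⇝here st) = [] , _ , _ , _ , refl , refl , st
⇝L-position (⇝there {d = x} st) with ⇝L-position st
... | pre , post , d , d₁ , refl , refl , st′ = x ∷ pre , post , d , d₁ , refl , refl , st′

Subst-bagL-step : ∀ {k c ds ds₁ e} → ds ⇝L ds₁ → Subst k c ds₁ e → Σ RTerm λ e₀ → Subst k c ds e₀ × e₀ ⇝ e
Subst-bagL-step st s with ⇝L-position st
... | pre , post , d , d₁ , refl , refl , st′
  with Subst-bag-step (Subst-resp-↭ s (↭-sym (Perm.shift d₁ pre post))) st′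
...   | e₀ , s′ , st″ = e₀ , Subst-resp-↭ s′ (Perm.shift d pre post) , st″

-- A step in the body becomes a step after substitution: if c ⇝ c₁ and
-- c₁[ds/k] = e then c[ds/k] ⇝ e.  A β-step in the body is the substitution lemma.
mutual
  Subst-body-step : ∀ {k c c₁ ds e} → c ⇝ c₁ → Subst k c₁ ds e → Σ RTerm λ e₀ → Subst k c ds e₀ × e₀ ⇝ e
  Subst-body-step {k} (⇝β s₀) s with Subst-compose 0 k s₀ s
  ... | dsᶠ , dsᵃ , f′ , fs′ , r , sf , sfs , se = rapp (rlam f′) fs′ , subapp (sublam sf) sfs r , ⇝β se
  Subst-body-step (⇝lam st) (sublam s) with Subst-body-step st s
  ... | e₀ , s′ , st′ = rlam e₀ , sublam s′ , ⇝lam st′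
  Subst-body-step (⇝fun st) (subapp s ss q) with Subst-body-step st s
  ... | e₀ , s′ , st′ = rapp e₀ _ , subapp s′ ss q , ⇝fun st′
  Subst-body-step (⇝arg st) (subapp s ss q) with SubstL-body-step st ss
  ... | es₀ , ss′ , st′ = rapp _ es₀ , subapp s ss′ q , ⇝arg st′

  SubstL-body-step : ∀ {k cs cs₁ ds es} → cs ⇝L cs₁ → SubstL k cs₁ ds es →
    Σ (List RTerm) λ es₀ → SubstL k cs ds es₀ × es₀ ⇝L es
  SubstL-body-step (⇝here st) (subcons s ss q) with Subst-body-step st s
  ... | e₀ , s′ , st′ = e₀ ∷ _ , subcons s′ ss q , ⇝here st′
  SubstL-body-step (⇝there st) (subcons s ss q) with SubstL-body-step st ss
  ... | es₀ , ss′ , st′ = _ ∷ es₀ , subcons s ss′ q , ⇝there st′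

-- The size of a rigid term, the measure of the induction for (i) ⇒ WN.
mutual
  size : RTerm → ℕ
  size (rvar _) = 1
  size (rlam a) = suc (size a)
  size (rapp a ds) = suc (size a + sizeL ds)

  sizeL : List RTerm → ℕ
  sizeL [] = 0
  sizeL (d ∷ ds) = size d + sizeL ds

sizeL≡sum : ∀ ds → sizeL ds ≡ sum (map size ds)
sizeL≡sum [] = refl
sizeL≡sum (d ∷ ds) = cong (size d +_) (sizeL≡sum ds)

sizeL-++ : ∀ xs ys → sizeL (xs ++ ys) ≡ sizeL xs + sizeL ys
sizeL-++ xs ys = begin
  sizeL (xs ++ ys)                      ≡⟨ sizeL≡sum (xs ++ ys) ⟩
  sum (map size (xs ++ ys))             ≡⟨ cong sum (map-++ size xs ys) ⟩
  sum (map size xs ++ map size ys)      ≡⟨ sum-++ (map size xs) (map size ys) ⟩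
  sum (map size xs) + sum (map size ys) ≡⟨ cong₂ _+_ (sizeL≡sum xs) (sizeL≡sum ys) ⟨
  sizeL xs + sizeL ys                   ∎
  where open ≡-Reasoning

sizeL-↭ : ∀ {xs ys} → xs ↭ ys → sizeL xs ≡ sizeL ys
sizeL-↭ {xs} {ys} p = begin
  sizeL xs          ≡⟨ sizeL≡sum xs ⟩
  sum (map size xs) ≡⟨ sum-↭ (Perm.map⁺ size p) ⟩
  sum (map size ys) ≡⟨ sizeL≡sum ys ⟨
  sizeL ys          ∎
  where open ≡-Reasoning

mutual
  size-rshift : ∀ c a → size (rshift c a) ≡ size a
  size-rshift c (rvar x) with c ≤ᵇ x
  ... | true = refl
  ... | false = refl
  size-rshift c (rlam a) = cong suc (size-rshift (suc c) a)
  size-rshift c (rapp a ds) = cong suc (cong₂ _+_ (size-rshift c a) (sizeL-rshift c ds))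

  sizeL-rshift : ∀ c ds → sizeL (rshiftL c ds) ≡ sizeL ds
  sizeL-rshift c [] = refl
  sizeL-rshift c (d ∷ ds) = cong₂ _+_ (size-rshift c d) (sizeL-rshift c ds)

size-rshiftN : ∀ n a → size (rshiftN n a) ≡ size a
size-rshiftN zero a = refl
size-rshiftN (suc n) a = trans (size-rshift 0 (rshiftN n a)) (size-rshiftN n a)

-- Rigid substitution is linear, so it never exceeds the sizes of the body and
-- the bag together; hence rigid β strictly decreases size.
mutual
  Subst-size : ∀ {k c ds e} → Subst k c ds e → size e ≤ size c + sizeL ds
  Subst-size (sub< _ _) = m≤m+n 1 _
  Subst-size {ds = ds} (sub≡ {k = k} {d = d} _ q) = begin
    size (rshiftN k d) ≡⟨ size-rshiftN k d ⟩
    size d             ≡⟨ +-identityʳ (size d) ⟨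
    sizeL [ d ]        ≡⟨ sizeL-↭ q ⟨
    sizeL ds           ≤⟨ n≤1+n _ ⟩
    suc (sizeL ds)     ∎
    where open ≤-Reasoning
  Subst-size (sub> _ _) = m≤m+n 1 _
  Subst-size (sublam s) = s≤s (Subst-size s)
  Subst-size {ds = ds} (subapp {a = a} {fs} {ds₁ = ds₁} {ds₂} {e} {es} s ss q) = s≤s (begin
    size e + sizeL es                              ≤⟨ +-mono-≤ (Subst-size s) (SubstL-size ss) ⟩
    (size a + sizeL ds₁) + (sizeL fs + sizeL ds₂)  ≡⟨ interchange (size a) (sizeL ds₁) (sizeL fs) (sizeL ds₂) ⟩
    (size a + sizeL fs) + (sizeL ds₁ + sizeL ds₂)  ≡⟨ cong (size a + sizeL fs +_) (trans (sizeL-↭ q) (sizeL-++ ds₁ ds₂)) ⟨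
    size a + sizeL fs + sizeL ds                   ∎)
    where open ≤-Reasoning

  SubstL-size : ∀ {k cs ds es} → SubstL k cs ds es → sizeL es ≤ sizeL cs + sizeL ds
  SubstL-size (subnil _) = z≤n
  SubstL-size {ds = ds} (subcons {f = f} {fs} {ds₁ = ds₁} {ds₂} {e} {es} s ss q) = begin
    size e + sizeL es                              ≤⟨ +-mono-≤ (Subst-size s) (SubstL-size ss) ⟩
    (size f + sizeL ds₁) + (sizeL fs + sizeL ds₂)  ≡⟨ interchange (size f) (sizeL ds₁) (sizeL fs) (sizeL ds₂) ⟩
    (size f + sizeL fs) + (sizeL ds₁ + sizeL ds₂)  ≡⟨ cong (size f + sizeL fs +_) (trans (sizeL-↭ q) (sizeL-++ ds₁ ds₂)) ⟨
    size f + sizeL fs + sizeL ds                   ∎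
    where open ≤-Reasoning

mutual
  ⟶r⇒⇝ : ∀ {a r} → a ⟶r r → ∀ {a′} → r ≡ just a′ → a ⇝ a′
  ⟶r⇒⇝ (rβ {a} {bs}) eq = ⇝β (rsubst-sound a bs eq)
  ⟶r⇒⇝ (rξlam {r = just _} st) refl = ⇝lam (⟶r⇒⇝ st refl)
  ⟶r⇒⇝ (rξl {r = just _} st) refl = ⇝fun (⟶r⇒⇝ st refl)
  ⟶r⇒⇝ (rξr {r = just _} st) refl = ⇝arg (⟶rL⇒⇝L st refl)

  ⟶rL⇒⇝L : ∀ {ds r} → ds ⟶rL r → ∀ {ds′} → r ≡ just ds′ → ds ⇝L ds′
  ⟶rL⇒⇝L (here {r = just _} st) refl = ⇝here (⟶r⇒⇝ st refl)
  ⟶rL⇒⇝L (there {r = just _} st) refl = ⇝there (⟶rL⇒⇝L st refl)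

⟶R*⇒⇝* : ∀ {x y} → x ⟶R* y → ∀ {a b} → x ≡ just a → y ≡ just b → a ⇝* b
⟶R*⇒⇝* ε refl refl = ε
⟶R*⇒⇝* (lift {r = just _} st ◅ rest) refl eq = ⟶r⇒⇝ st refl ◅ ⟶R*⇒⇝* rest refl eq
⟶R*⇒⇝* (lift {r = nothing} st ◅ ε) refl ()
⟶R*⇒⇝* (lift {r = nothing} st ◅ (() ◅ rest)) refl eq

mutual
  data Nf : RTerm → Set where
    nlam : ∀ {a} → Nf a → Nf (rlam a)
    nne  : ∀ {a} → Ne a → Nf a

  data Ne : RTerm → Set where
    nvar : ∀ {x} → Ne (rvar x)
    napp : ∀ {a ds} → Ne a → All Nf ds → Ne (rapp a ds)

Nf-rapp⇒Ne : ∀ {a ds} → Nf (rapp a ds) → Ne (rapp a ds)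
Nf-rapp⇒Ne (nne n) = n

mutual
  rNormal⇒Nf : ∀ b → rNormal b → Nf b
  rNormal⇒Nf (rvar x) _ = nne nvar
  rNormal⇒Nf (rlam a) n = nlam (rNormal⇒Nf a (λ _ st → n _ (rξlam st)))
  rNormal⇒Nf (rapp (rvar x) ds) n = nne (napp nvar (rNormal⇒AllNf ds (λ _ st → n _ (rξr st))))
  rNormal⇒Nf (rapp (rlam a) ds) n = ⊥-elim (n _ rβ)
  rNormal⇒Nf (rapp (rapp c es) ds) n =
    nne (napp (Nf-rapp⇒Ne (rNormal⇒Nf (rapp c es) (λ _ st → n _ (rξl st))))
              (rNormal⇒AllNf ds (λ _ st → n _ (rξr st))))

  rNormal⇒AllNf : ∀ ds → (∀ r → ¬ (ds ⟶rL r)) → All Nf ds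
  rNormal⇒AllNf [] _ = []
  rNormal⇒AllNf (d ∷ ds) n = rNormal⇒Nf d (λ _ st → n _ (here st)) ∷ rNormal⇒AllNf ds (λ _ st → n _ (there st))

-- Application spines.  `apps h us` applies h to the arguments us listed from the
-- last one to the first; `rapps` is the rigid analogue with a bag per argument.
apps : Term → List Term → Term
apps h [] = h
apps h (u ∷ us) = app (apps h us) u

rapps : RTerm → List (List RTerm) → RTerm
rapps c [] = c
rapps c (ds ∷ dss) = rapp (rapps c dss) ds

data Spine : Term → Set where
  lam-spine   : ∀ t → Spine (lam t)
  var-spine   : ∀ x us → Spine (apps (var x) us)
  redex-spine : ∀ P Q us → Spine (apps (app (lam P) Q) us)

spine : ∀ M → Spine M
spine (var x) = var-spine x []
spine (lam t) = lam-spine t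
spine (app t u) with spine t
... | lam-spine P = redex-spine P u []
... | var-spine x us = var-spine x (u ∷ us)
... | redex-spine P Q us = redex-spine P Q (u ∷ us)

BagsTr : List (List RTerm) → List Term → Set
BagsTr = Pointwise (λ ds u → All (_∈Tr u) ds)

apps-∈Tr⁻ : ∀ h us {a} → a ∈Tr apps h us →
  Σ RTerm λ c → Σ (List (List RTerm)) λ dss → a ≡ rapps c dss × c ∈Tr h × BagsTr dss us
apps-∈Tr⁻ h [] t = _ , [] , refl , t , []
apps-∈Tr⁻ h (u ∷ us) (tapp t ts) with apps-∈Tr⁻ h us t
... | c , dss , refl , tc , bs = c , _ ∷ dss , refl , tc , ts ∷ bs

apps-∈Tr : ∀ {c h dss us} → c ∈Tr h → BagsTr dss us → rapps c dss ∈Tr apps h us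
apps-∈Tr tc [] = tc
apps-∈Tr tc (ts ∷ bs) = tapp (apps-∈Tr tc bs) ts

⇝*-lam-inv : ∀ {x b} → x ⇝* b → ∀ {a} → x ≡ rlam a → Σ RTerm λ b₁ → b ≡ rlam b₁ × a ⇝* b₁
⇝*-lam-inv ε refl = _ , refl , ε
⇝*-lam-inv (⇝lam st ◅ rest) refl with ⇝*-lam-inv rest refl
... | b₁ , refl , r = b₁ , refl , st ◅ r

BagsReduce : List (List RTerm) → List (List RTerm) → Set
BagsReduce = Pointwise (Pointwise _⇝*_)

BagsReduce-refl : ∀ {dss} → BagsReduce dss dss
BagsReduce-refl = Pointwise.refl (Pointwise.refl ε)

BagsReduce-trans : ∀ {xss yss zss} → BagsReduce xss yss → BagsReduce yss zss → BagsReduce xss zss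
BagsReduce-trans = Pointwise.transitive (Pointwise.transitive _◅◅_)

⇝L⇒Pointwise : ∀ {ds ds′} → ds ⇝L ds′ → Pointwise _⇝*_ ds ds′
⇝L⇒Pointwise (⇝here st) = (st ◅ ε) ∷ Pointwise.refl ε
⇝L⇒Pointwise (⇝there st) = ε ∷ ⇝L⇒Pointwise st

var-spine-step-inv : ∀ {x} dss {r} → rapps (rvar x) dss ⇝ r →
  Σ (List (List RTerm)) λ dss′ → r ≡ rapps (rvar x) dss′ × BagsReduce dss dss′
var-spine-step-inv (ds ∷ []) (⇝arg st) = _ , refl , ⇝L⇒Pointwise st ∷ []
var-spine-step-inv (ds ∷ ds₂ ∷ dss) (⇝fun st) with var-spine-step-inv (ds₂ ∷ dss) st
... | dss′ , refl , bb = ds ∷ dss′ , refl , Pointwise.refl ε ∷ bb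
var-spine-step-inv (ds ∷ ds₂ ∷ dss) (⇝arg st) = _ , refl , ⇝L⇒Pointwise st ∷ BagsReduce-refl

var-spine-inv : ∀ {y b} → y ⇝* b → ∀ {x} dss → y ≡ rapps (rvar x) dss →
  Σ (List (List RTerm)) λ dss′ → b ≡ rapps (rvar x) dss′ × BagsReduce dss dss′
var-spine-inv ε dss refl = dss , refl , BagsReduce-refl
var-spine-inv (st ◅ rest) dss refl with var-spine-step-inv dss st
... | dss₁ , refl , bb₁ with var-spine-inv rest dss₁ refl
...   | dss′ , refl , bb₂ = dss′ , refl , BagsReduce-trans bb₁ bb₂

data ArgStep : List (List RTerm) → List (List RTerm) → Set where
  ahere  : ∀ {ds ds′ dss} → ds ⇝L ds′ → ArgStep (ds ∷ dss) (ds′ ∷ dss)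
  athere : ∀ {ds dss dss′} → ArgStep dss dss′ → ArgStep (ds ∷ dss) (ds ∷ dss′)

ArgStep⇒⇝ : ∀ {h dss dss₁} → ArgStep dss dss₁ → rapps h dss ⇝ rapps h dss₁
ArgStep⇒⇝ (ahere st) = ⇝arg st
ArgStep⇒⇝ (athere st) = ⇝fun (ArgStep⇒⇝ st)

head-⇝ : ∀ {h h′} dss → h ⇝ h′ → rapps h dss ⇝ rapps h′ dss
head-⇝ [] st = st
head-⇝ (ds ∷ dss) st = ⇝fun (head-⇝ dss st)

data HeadRedexStep (c : RTerm) (ds : List RTerm) (dss : List (List RTerm)) : RTerm → Set where
  fired   : ∀ {e} → Subst 0 c ds e → HeadRedexStep c ds dss (rapps e dss)
  in-body : ∀ {c₁} → c ⇝ c₁ → HeadRedexStep c ds dss (rapps (rapp (rlam c₁) ds) dss)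
  in-bag  : ∀ {ds₁} → ds ⇝L ds₁ → HeadRedexStep c ds dss (rapps (rapp (rlam c) ds₁) dss)
  in-args : ∀ {dss₁} → ArgStep dss dss₁ → HeadRedexStep c ds dss (rapps (rapp (rlam c) ds) dss₁)

HeadRedexStep-extend : ∀ {c ds dss es r} → HeadRedexStep c ds dss r → HeadRedexStep c ds (es ∷ dss) (rapp r es)
HeadRedexStep-extend (fired s) = fired s
HeadRedexStep-extend (in-body st) = in-body st
HeadRedexStep-extend (in-bag st) = in-bag st
HeadRedexStep-extend (in-args st) = in-args (athere st)

head-redex-step-inv : ∀ {c ds} dss {r} → rapps (rapp (rlam c) ds) dss ⇝ r → HeadRedexStep c ds dss r
head-redex-step-inv [] (⇝β s) = fired s
head-redex-step-inv [] (⇝fun (⇝lam st)) = in-body st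
head-redex-step-inv [] (⇝arg st) = in-bag st
head-redex-step-inv (es ∷ []) (⇝fun st) = HeadRedexStep-extend (head-redex-step-inv [] st)
head-redex-step-inv (es ∷ es₂ ∷ dss) (⇝fun st) = HeadRedexStep-extend (head-redex-step-inv (es₂ ∷ dss) st)
head-redex-step-inv (es ∷ dss) (⇝arg st) = in-args (ahere st)

head-redex-¬Nf : ∀ {c ds} dss → ¬ Nf (rapps (rapp (rlam c) ds) dss)
head-redex-¬Nf [] (nne (napp () _))
head-redex-¬Nf (es ∷ dss) (nne (napp n _)) = head-redex-¬Nf dss (nne n)

-- Postponement: a reduction of a head-redex spine to a normal form can be
-- rearranged to contract the head redex first, because steps in the body or
-- in the bag commute with the substitution.
postpone : ∀ {y b} → y ⇝* b → Nf b → ∀ {c ds} dss → y ≡ rapps (rapp (rlam c) ds) dss →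
  Σ RTerm λ e → Subst 0 c ds e × rapps e dss ⇝* b
postpone ε nb dss refl = ⊥-elim (head-redex-¬Nf dss nb)
postpone (st ◅ rest) nb dss refl with head-redex-step-inv dss st
... | fired s = _ , s , rest
... | in-body st′ with postpone rest nb dss refl
...   | _ , s₁ , r₁ with Subst-body-step st′ s₁
...     | e₀ , s₀ , st₀ = e₀ , s₀ , head-⇝ dss st₀ ◅ r₁
postpone (st ◅ rest) nb dss refl | in-bag st′ with postpone rest nb dss refl
...   | _ , s₁ , r₁ with Subst-bagL-step st′ s₁
...     | e₀ , s₀ , st₀ = e₀ , s₀ , head-⇝ dss st₀ ◅ r₁
postpone (st ◅ rest) nb dss refl | in-args a with postpone rest nb _ refl
...   | e , s , r₁ = e , s , ArgStep⇒⇝ a ◅ r₁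

-- Inductive normalisation, one rule per clause of L: an abstraction with a
-- normalising body, a variable applied to normalising arguments, and a head
-- redex whose contractum normalises.
data WN : Term → Set where
  wn-lam   : ∀ {t} → WN t → WN (lam t)
  wn-var   : ∀ x us → All WN us → WN (apps (var x) us)
  wn-redex : ∀ P Q us → WN (apps (P [ Q ]β) us) → WN (apps (app (lam P) Q) us)

bags-smaller : ∀ h dss → All (λ ds → sizeL ds < size (rapps h dss)) dss
bags-smaller h [] = []
bags-smaller h (ds ∷ dss) =
  s≤s (m≤n+m (sizeL ds) (size (rapps h dss))) ∷
  All-map (λ lt → <-trans lt (s≤s (m≤m+n _ (sizeL ds)))) (bags-smaller h dss)

rapps-mono : ∀ {h h′} dss → size h < size h′ → size (rapps h dss) < size (rapps h′ dss)
rapps-mono [] lt = lt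
rapps-mono (ds ∷ dss) lt = s≤s (+-monoˡ-< (sizeL ds) (rapps-mono dss lt))

FirstPositive : List RTerm → Set
FirstPositive ds = Σ RTerm λ d → Σ (List RTerm) λ ds₀ → ds ≡ d ∷ ds₀ × Positive d × Nf d

-- Positivity forbids empty bags: every bag of a positive normal variable spine
-- has a positive normal first member.
var-spine-bags : ∀ {x} dss → Positive (rapps (rvar x) dss) → Nf (rapps (rvar x) dss) → All FirstPositive dss
var-spine-bags [] _ _ = []
var-spine-bags (ds ∷ dss) (papp pc (pd ∷ _)) (nne (napp ne (nd ∷ _))) =
  (_ , _ , refl , pd , nd) ∷ var-spine-bags dss pc (nne ne)

WN-below : ℕ → Set
WN-below n = ∀ {M a b} → size a < n → a ∈Tr M → a ⇝* b → Nf b → Positive b → WN M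

-- The arguments of a variable spine normalise: each bag reduces to one with a
-- positive normal first member, and that member's origin is a smaller expansion.
arguments-WN : ∀ {n dss us dss′} → WN-below n → BagsTr dss us → BagsReduce dss dss′ →
  All FirstPositive dss′ → All (λ ds → sizeL ds < n) dss → All WN us
arguments-WN ih [] [] [] [] = []
arguments-WN {dss = (d ∷ ds₀) ∷ _} ih ((td ∷ _) ∷ bs) ((r ∷ _) ∷ bb) ((_ , _ , refl , pd , nd) ∷ fps) (lt ∷ lts) =
  ih (≤-<-trans (m≤m+n (size d) (sizeL ds₀)) lt) td r nd pd ∷ arguments-WN ih bs bb fps lts
arguments-WN ih (_ ∷ _) ([] ∷ _) ((_ , _ , () , _) ∷ _) _

positive-nf⇒WN : ∀ n → WN-below n
positive-nf⇒WN zero () _ _ _ _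
positive-nf⇒WN (suc n) {M} lt t r nb pb with spine M
positive-nf⇒WN (suc n) lt (tlam ta) r nb pb | lam-spine _ with ⇝*-lam-inv r refl
... | _ , refl , r₁ with nb | pb
...   | nlam nb₁ | plam pb₁ = wn-lam (positive-nf⇒WN n (≤-pred lt) ta r₁ nb₁ pb₁)
positive-nf⇒WN (suc n) lt t r nb pb | var-spine x us with apps-∈Tr⁻ (var x) us t
... | _ , dss , refl , tvar , bs with var-spine-inv r dss refl
...   | dss′ , refl , bb =
  wn-var x us (arguments-WN (positive-nf⇒WN n) bs bb (var-spine-bags dss′ pb nb)
                (All-map (λ lt′ → <-≤-trans lt′ (≤-pred lt)) (bags-smaller (rvar x) dss)))
positive-nf⇒WN (suc n) lt t r nb pb | redex-spine P Q us with apps-∈Tr⁻ (app (lam P) Q) us t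
... | _ , dss , refl , tapp (tlam tc) tds , bs with postpone r nb dss refl
...   | e , s , r′ = wn-redex P Q us (positive-nf⇒WN n smaller (apps-∈Tr (Subst-∈Tr s tc tds) bs) r′ nb pb)
  where
  smaller : size (rapps e dss) < n
  smaller = <-≤-trans (rapps-mono dss (s≤s (≤-trans (Subst-size s) (n≤1+n _)))) (≤-pred lt)

headVar-var-spine : ∀ x us → headVar (apps (var x) us) ≡ true
headVar-var-spine x [] = refl
headVar-var-spine x (u ∷ us) = headVar-var-spine x us

headVar-redex-spine : ∀ P Q us → headVar (apps (app (lam P) Q) us) ≡ false
headVar-redex-spine P Q [] = refl
headVar-redex-spine P Q (u ∷ us) = headVar-redex-spine P Q us

L-app-var-head : ∀ A s u → headVar A ≡ true → L (app (app A s) u) ≡ app (L (app A s)) (L u)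
L-app-var-head A s u eq rewrite eq = refl

L-app-redex-head : ∀ A s u → headVar A ≡ false → L (app (app A s) u) ≡ app (L (app A s)) u
L-app-redex-head A s u eq rewrite eq = refl

L-var-spine : ∀ x us → L (apps (var x) us) ≡ apps (var x) (map L us)
L-var-spine x [] = refl
L-var-spine x (u ∷ []) = refl
L-var-spine x (u ∷ u₂ ∷ us) =
  trans (L-app-var-head (apps (var x) us) u₂ u (headVar-var-spine x us)) (cong (λ h → app h (L u)) (L-var-spine x (u₂ ∷ us)))

L-redex-spine : ∀ P Q us → L (apps (app (lam P) Q) us) ≡ apps (P [ Q ]β) us
L-redex-spine P Q [] = refl
L-redex-spine P Q (u ∷ []) = refl
L-redex-spine P Q (u ∷ u₂ ∷ us) =
  trans (L-app-redex-head (apps (app (lam P) Q) us) u₂ u (headVar-redex-spine P Q us)) (cong (λ h → app h u) (L-redex-spine P Q (u₂ ∷ us)))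

L-iterate-suc : ∀ m M → Literate (suc m) M ≡ Literate m (L M)
L-iterate-suc zero M = refl
L-iterate-suc (suc m) M = cong L (L-iterate-suc m M)

L-iterate-lam : ∀ m t → Literate m (lam t) ≡ lam (Literate m t)
L-iterate-lam zero t = refl
L-iterate-lam (suc m) t = cong L (L-iterate-lam m t)

L-iterate-var-spine : ∀ m x us → Literate m (apps (var x) us) ≡ apps (var x) (map (Literate m) us)
L-iterate-var-spine zero x us = cong (apps (var x)) (sym (map-id us))
L-iterate-var-spine (suc m) x us = begin
  L (Literate m (apps (var x) us))          ≡⟨ cong L (L-iterate-var-spine m x us) ⟩
  L (apps (var x) (map (Literate m) us))    ≡⟨ L-var-spine x (map (Literate m) us) ⟩
  apps (var x) (map L (map (Literate m) us)) ≡⟨ cong (apps (var x)) (map-∘ us) ⟨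
  apps (var x) (map (Literate (suc m)) us)  ∎
  where open ≡-Reasoning

βNormal-lam : ∀ {t} → βNormal t → βNormal (lam t)
βNormal-lam n _ (ξlam st) = n _ st

βNormal-var-spine : ∀ x us → All βNormal us → βNormal (apps (var x) us)
βNormal-var-spine x (u ∷ []) (nu ∷ _) _ (ξr st) = nu _ st
βNormal-var-spine x (u ∷ u₂ ∷ us) (_ ∷ ns) _ (ξl st) = βNormal-var-spine x (u₂ ∷ us) ns _ st
βNormal-var-spine x (u ∷ u₂ ∷ us) (nu ∷ _) _ (ξr st) = nu _ st

Eventually : (ℕ → Set) → Set
Eventually P = Σ ℕ λ m → ∀ m′ → m ≤ m′ → P m′

mutual
  WN⇒L-normalises : ∀ {M} → WN M → Eventually (λ m → βNormal (Literate m M))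
  WN⇒L-normalises (wn-lam {t} w) with WN⇒L-normalises w
  ... | m , normal = m , λ m′ m≤m′ → Eq.subst βNormal (sym (L-iterate-lam m′ t)) (βNormal-lam (normal m′ m≤m′))
  WN⇒L-normalises (wn-var x us ws) with WNs⇒L-normalise ws
  ... | m , normal = m , λ m′ m≤m′ →
    Eq.subst βNormal (sym (L-iterate-var-spine m′ x us)) (βNormal-var-spine x _ (All.map⁺ (normal m′ m≤m′)))
  WN⇒L-normalises (wn-redex P Q us w) with WN⇒L-normalises w
  ... | m , normal = suc m , λ where
    (suc m′) (s≤s m≤m′) → Eq.subst βNormal (sym (trans (L-iterate-suc m′ _) (cong (Literate m′) (L-redex-spine P Q us))))
                                   (normal m′ m≤m′)

  WNs⇒L-normalise : ∀ {us} → All WN us → Eventually (λ m → All (λ u → βNormal (Literate m u)) us)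
  WNs⇒L-normalise [] = 0 , λ _ _ → []
  WNs⇒L-normalise (w ∷ ws) with WN⇒L-normalises w | WNs⇒L-normalise ws
  ... | m₁ , normal₁ | m₂ , normal₂ = m₁ ⊔ m₂ , λ m′ le →
    normal₁ m′ (≤-trans (m≤m⊔n m₁ m₂) le) ∷ normal₂ m′ (≤-trans (m≤n⊔m m₁ m₂) le)

-- Backward simulation of L by L_r: every expansion of L(M) is L_r of an
-- expansion of M, because the two are defined by the same clauses and rigid
-- expansions have the same head as their λ-term.

∈Tr-headVar : ∀ {c t} → c ∈Tr t → headVarR c ≡ headVar t
∈Tr-headVar tvar = refl
∈Tr-headVar (tlam _) = refl
∈Tr-headVar (tapp t _) = ∈Tr-headVar t

Lr-app-var-head : ∀ c ds₁ ds → headVarR c ≡ true →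
  Lr (rapp (rapp c ds₁) ds) ≡ (Lr (rapp c ds₁) >>= λ c′ → Maybe.map (rapp c′) (LrL ds))
Lr-app-var-head c ds₁ ds eq rewrite eq = refl

Lr-app-redex-head : ∀ c ds₁ ds → headVarR c ≡ false →
  Lr (rapp (rapp c ds₁) ds) ≡ Maybe.map (λ c′ → rapp c′ ds) (Lr (rapp c ds₁))
Lr-app-redex-head c ds₁ ds eq rewrite eq = refl

mutual
  L-∈Tr⁻ : ∀ M {b} → b ∈Tr L M → Σ RTerm λ a → a ∈Tr M × Lr a ≡ just b
  L-∈Tr⁻ (var x) tvar = rvar x , tvar , refl
  L-∈Tr⁻ (lam t) (tlam tb) with L-∈Tr⁻ t tb
  ... | a , ta , eq = rlam a , tlam ta , cong (Maybe.map rlam) eq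
  L-∈Tr⁻ (app (var x) u) (tapp tvar tbs) with Ls-∈Tr⁻ u tbs
  ... | as , tas , eq = rapp (rvar x) as , tapp tvar tas , cong (Maybe.map (rapp (rvar x))) eq
  L-∈Tr⁻ (app (lam t) u) tb with β-∈Tr⁻ t u tb
  ... | c , ds , tc , tds , eq = rapp (rlam c) ds , tapp (tlam tc) tds , eq
  L-∈Tr⁻ (app (app t s) u) tb with headVar t in hv
  L-∈Tr⁻ (app (app t s) u) (tapp tb₁ tbs) | true with L-∈Tr⁻ (app t s) tb₁ | Ls-∈Tr⁻ u tbs
  ... | rapp c ds₁ , tapp tc tds , eq₁ | as , tas , eq₂ =
    rapp (rapp c ds₁) as , tapp (tapp tc tds) tas ,
    trans (Lr-app-var-head c ds₁ as (trans (∈Tr-headVar tc) hv))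
          (cong₂ (λ x y → x >>= λ c′ → Maybe.map (rapp c′) y) eq₁ eq₂)
  L-∈Tr⁻ (app (app t s) u) (tapp tb₁ tbs) | false with L-∈Tr⁻ (app t s) tb₁
  ... | rapp c ds₁ , tapp tc tds , eq₁ =
    rapp (rapp c ds₁) _ , tapp (tapp tc tds) tbs ,
    trans (Lr-app-redex-head c ds₁ _ (trans (∈Tr-headVar tc) hv)) (cong (Maybe.map _) eq₁)

  Ls-∈Tr⁻ : ∀ u {bs} → All (_∈Tr L u) bs → Σ (List RTerm) λ as → All (_∈Tr u) as × LrL as ≡ just bs
  Ls-∈Tr⁻ u [] = [] , [] , refl
  Ls-∈Tr⁻ u (tb ∷ tbs) with L-∈Tr⁻ u tb | Ls-∈Tr⁻ u tbs
  ... | a , ta , eq₁ | as , tas , eq₂ =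
    a ∷ as , ta ∷ tas , cong₂ (λ x y → x >>= λ a′ → Maybe.map (a′ ∷_) y) eq₁ eq₂

L-iterate-∈Tr⁻ : ∀ m M {b} → b ∈Tr Literate m M → Σ RTerm λ a → a ∈Tr M × LrIterate m a ≡ just b
L-iterate-∈Tr⁻ zero M tb = _ , tb , refl
L-iterate-∈Tr⁻ (suc m) M tb with L-∈Tr⁻ (Literate m M) tb
... | b₀ , tb₀ , eq₀ with L-iterate-∈Tr⁻ m M tb₀
...   | a , ta , eqm = a , ta , trans (cong LrM eqm) eq₀

-- The full expansion of a λ-term uses a singleton bag for every argument.  It
-- is positive, and it is →r-normal when the λ-term is β-normal, since each of
-- its rigid steps mirrors a β-step.
full : Term → RTerm
full (var x) = rvar x
full (lam t) = rlam (full t)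
full (app t u) = rapp (full t) [ full u ]

full-∈Tr : ∀ N → full N ∈Tr N
full-∈Tr (var x) = tvar
full-∈Tr (lam t) = tlam (full-∈Tr t)
full-∈Tr (app t u) = tapp (full-∈Tr t) (full-∈Tr u ∷ [])

full-Positive : ∀ N → Positive (full N)
full-Positive (var x) = pvar
full-Positive (lam t) = plam (full-Positive t)
full-Positive (app t u) = papp (full-Positive t) (full-Positive u ∷ [])

full-step : ∀ N {r} → full N ⟶r r → Σ Term λ N′ → N →β N′
full-step (app (lam t) u) rβ = _ , β
full-step (lam t) (rξlam st) with full-step t st
... | _ , st′ = _ , ξlam st′
full-step (app t u) (rξl st) with full-step t st
... | _ , st′ = _ , ξl st′
full-step (app t u) (rξr (here st)) with full-step u st
... | _ , st′ = _ , ξr st′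

full-rNormal : ∀ N → βNormal N → rNormal (full N)
full-rNormal N n _ st with full-step N st
... | _ , st′ = n _ st′

-- (iii) ⇒ (ii): pull the full expansion of the normal iterate back along L.
iii⇒ii : ∀ M → LNormalises M → LrNormalises M
iii⇒ii M (m , n) with L-iterate-∈Tr⁻ m M (full-∈Tr (Literate m M))
... | a , ta , eq = a , ta , m , _ , eq , full-Positive _ , full-rNormal _ n

data OnMaybe {X : Set} (S : X → Maybe X → Set) : Maybe X → Maybe X → Set where
  step : ∀ {x r} → S x r → OnMaybe S (just x) r

_⟶r*_ : Maybe RTerm → Maybe RTerm → Set
_⟶r*_ = Star (OnMaybe _⟶r_)

_⟶rL*_ : Maybe (List RTerm) → Maybe (List RTerm) → Set
_⟶rL*_ = Star (OnMaybe _⟶rL_)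

⟶r*⇒⟶R* : ∀ {x y} → x ⟶r* y → x ⟶R* y
⟶r*⇒⟶R* ε = ε
⟶r*⇒⟶R* (step st ◅ rest) = lift st ◅ ⟶r*⇒⟶R* rest

lift-context : ∀ {X Y : Set} {S : X → Maybe X → Set} {S′ : Y → Maybe Y → Set} (f : X → Y) →
  (∀ {x r} → S x r → S′ (f x) (Maybe.map f r)) →
  ∀ {y r} → Star (OnMaybe S) y r → ∀ {x} → y ≡ just x → Star (OnMaybe S′) (just (f x)) (Maybe.map f r)
lift-context f g ε refl = ε
lift-context f g (step {r = just _} st ◅ rest) refl = step (g st) ◅ lift-context f g rest refl
lift-context f g (step {r = nothing} st ◅ ε) refl = step (g st) ◅ ε
lift-context f g (step {r = nothing} st ◅ (() ◅ rest)) refl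

mutual
  Lr-reduces : ∀ a → just a ⟶r* Lr a
  Lr-reduces (rvar x) = ε
  Lr-reduces (rlam c) = lift-context rlam rξlam (Lr-reduces c) refl
  Lr-reduces (rapp (rvar x) ds) = lift-context (rapp (rvar x)) rξr (LrL-reduces ds) refl
  Lr-reduces (rapp (rlam c) ds) = step rβ ◅ ε
  Lr-reduces (rapp (rapp c ds₁) ds) = by-head (headVarR c) (Lr (rapp c ds₁)) (Lr-reduces (rapp c ds₁))
    where
    in-fun : ∀ {r} → just (rapp c ds₁) ⟶r* r → just (rapp (rapp c ds₁) ds) ⟶r* Maybe.map (λ c′ → rapp c′ ds) r
    in-fun red = lift-context (λ c′ → rapp c′ ds) rξl red refl

    by-head : ∀ hv r → just (rapp c ds₁) ⟶r* r → just (rapp (rapp c ds₁) ds) ⟶r*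
      (if hv then (r >>= λ c′ → Maybe.map (rapp c′) (LrL ds)) else Maybe.map (λ c′ → rapp c′ ds) r)
    by-head true nothing red = in-fun red
    by-head true (just c′) red = in-fun red ◅◅ lift-context (rapp c′) rξr (LrL-reduces ds) refl
    by-head false r red = in-fun red

  LrL-reduces : ∀ ds → just ds ⟶rL* LrL ds
  LrL-reduces [] = ε
  LrL-reduces (d ∷ ds) = then-tail (Lr d) (Lr-reduces d)
    where
    in-head : ∀ {r} → just d ⟶r* r → just (d ∷ ds) ⟶rL* Maybe.map (_∷ ds) r
    in-head red = lift-context (_∷ ds) here red refl

    then-tail : ∀ r → just d ⟶r* r → just (d ∷ ds) ⟶rL* (r >>= λ d′ → Maybe.map (d′ ∷_) (LrL ds))
    then-tail nothing red = in-head red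
    then-tail (just d′) red = in-head red ◅◅ lift-context (d′ ∷_) there (LrL-reduces ds) refl

LrIterate-reduces : ∀ m a → just a ⟶r* LrIterate m a
LrIterate-reduces zero a = ε
LrIterate-reduces (suc m) a = then-Lr (LrIterate m a) (LrIterate-reduces m a)
  where
  then-Lr : ∀ r → just a ⟶r* r → just a ⟶r* LrM r
  then-Lr nothing red = red
  then-Lr (just x) red = red ◅◅ Lr-reduces x

ii⇒i : ∀ M → LrNormalises M → PositiveNF M
ii⇒i M (a , ta , m , b , eq , pb , nb) =
  a , ta , b , (⟶r*⇒⟶R* (Eq.subst (just a ⟶r*_) eq (LrIterate-reduces m a)) , nb) , pb

L-reduces : ∀ M → M →β* L M
L-reduces (var x) = ε
L-reduces (lam t) = gmap lam ξlam (L-reduces t)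
L-reduces (app (var x) u) = gmap (app (var x)) ξr (L-reduces u)
L-reduces (app (lam t) u) = β ◅ ε
L-reduces (app (app t s) u) = by-head (headVar t) (L-reduces (app t s)) (L-reduces u)
  where
  by-head : ∀ hv → app t s →β* L (app t s) → u →β* L u →
    app (app t s) u →β* (if hv then app (L (app t s)) (L u) else app (L (app t s)) u)
  by-head true red₁ red₂ = gmap (λ h → app h u) ξl red₁ ◅◅ gmap (app (L (app t s))) ξr red₂
  by-head false red₁ _ = gmap (λ h → app h u) ξl red₁

L-iterate-reduces : ∀ m M → M →β* Literate m M
L-iterate-reduces zero M = ε
L-iterate-reduces (suc m) M = L-iterate-reduces m M ◅◅ L-reduces (Literate m M)

iii⇒iv : ∀ M → LNormalises M → βNormalizable M
iii⇒iv M (m , n) = Literate m M , L-iterate-reduces m M , n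

mutual
  →β-∈Tr⁻ : ∀ {M M′} → M →β M′ → ∀ {a′} → a′ ∈Tr M′ → Σ RTerm λ a → a ∈Tr M × just a ⟶r* just a′
  →β-∈Tr⁻ (β {P} {Q}) ta′ with β-∈Tr⁻ P Q ta′
  ... | c , ds , tc , tds , eq =
    rapp (rlam c) ds , tapp (tlam tc) tds , Eq.subst (OnMaybe _⟶r_ (just (rapp (rlam c) ds))) eq (step rβ) ◅ ε
  →β-∈Tr⁻ (ξlam st) (tlam ta′) with →β-∈Tr⁻ st ta′
  ... | a , ta , red = rlam a , tlam ta , lift-context rlam rξlam red refl
  →β-∈Tr⁻ (ξl st) (tapp {ds = ds} ta′ tds) with →β-∈Tr⁻ st ta′
  ... | a , ta , red = rapp a ds , tapp ta tds , lift-context (λ h → rapp h ds) rξl red refl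
  →β-∈Tr⁻ (ξr st) (tapp {c = c} tc tds′) with →β-∈TrL⁻ st tds′
  ... | ds , tds , red = rapp c ds , tapp tc tds , lift-context (rapp c) rξr red refl

  →β-∈TrL⁻ : ∀ {Q Q′} → Q →β Q′ → ∀ {ds′} → All (_∈Tr Q′) ds′ →
    Σ (List RTerm) λ ds → All (_∈Tr Q) ds × just ds ⟶rL* just ds′
  →β-∈TrL⁻ st [] = [] , [] , ε
  →β-∈TrL⁻ st (td′ ∷ tds′) with →β-∈Tr⁻ st td′ | →β-∈TrL⁻ st tds′
  ... | d , td , red₁ | ds , tds , red₂ =
    d ∷ ds , td ∷ tds , lift-context (_∷ ds) here red₁ refl ◅◅ lift-context (_ ∷_) there red₂ refl

→β*-∈Tr⁻ : ∀ {M N} → M →β* N → ∀ {b} → b ∈Tr N → Σ RTerm λ a → a ∈Tr M × just a ⟶r* just b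
→β*-∈Tr⁻ ε tb = _ , tb , ε
→β*-∈Tr⁻ (st ◅ rest) tb with →β*-∈Tr⁻ rest tb
... | a₁ , ta₁ , red₁ with →β-∈Tr⁻ st ta₁
...   | a , ta , red = a , ta , red ◅◅ red₁

-- (iv) ⇒ (i): pull the full expansion of the normal form back along β.
iv⇒i : ∀ M → βNormalizable M → PositiveNF M
iv⇒i M (N , red , n) with →β*-∈Tr⁻ red (full-∈Tr N)
... | a , ta , red′ = a , ta , full N , (⟶r*⇒⟶R* red′ , full-rNormal N n) , full-Positive N

i⇒WN : ∀ M → PositiveNF M → WN M
i⇒WN M (a , ta , b , (red , nb) , pb) =
  positive-nf⇒WN (suc (size a)) ≤-refl ta (⟶R*⇒⇝* red refl refl) (rNormal⇒Nf b nb) pb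

WN⇒iii : ∀ {M} → WN M → LNormalises M
WN⇒iii w with WN⇒L-normalises w
... | m , normal = m , normal m ≤-refl

i⇒iii : ∀ M → PositiveNF M → LNormalises M
i⇒iii M = WN⇒iii ∘ i⇒WN M

mainTheorem2 : (M : Term) →
    ((Σ RTerm λ a → a ∈Tr M × Σ RTerm λ b → NFis a (just b) × Positive b)
      ⇔ (Σ RTerm λ a → a ∈Tr M × Σ ℕ λ m → Σ RTerm λ b → LrIterate m a ≡ just b × Positive b × rNormal b))
    × ((Σ RTerm λ a → a ∈Tr M × Σ ℕ λ m → Σ RTerm λ b → LrIterate m a ≡ just b × Positive b × rNormal b)
      ⇔ (Σ ℕ λ m → βNormal (Literate m M)))
    × ((Σ ℕ λ m → βNormal (Literate m M)) ⇔ βNormalizable M)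
mainTheorem2 M =
  mk⇔ (iii⇒ii M ∘ i⇒iii M) (ii⇒i M) ,
  mk⇔ (i⇒iii M ∘ ii⇒i M) (iii⇒ii M) ,
  mk⇔ (iii⇒iv M) (i⇒iii M ∘ iv⇒i M)
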